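{- Fix positive integers $k<n$. Let $\alpha$ be a cylindric partition on $\mathcal{C}_{k,n}$ and $m$ a nonnegative integer. Let $M$ be the set of cylindric partitions $\mu\subseteq\alpha$ such that $\alpha/\mu$ contains exactly $m$ boxes, and $\Lambda$ the set of cylindric partitions $\lambda\supseteq\alpha$ such that $\lambda/\alpha$ contains exactly $m$ boxes. Then \[ \sum_{\mu\in M} f_{\alpha/\mu} = \sum_{\lambda\in\Lambda} f_{\lambda/\alpha}. \]
   Context: The cylinder $\mathcal{C}_{k,n}$ is $\mathbb{Z}^2/(-k,n-k)\mathbb{Z}$; boxes are its elements (classes of points $(x,y)$, $x$ the row, $y$ the column). A cylindric partition is a weakly decreasing bi-infinite integer sequence $(\lambda_i)$ with $\lambda_i=\lambda_{i+k}+n-k$. A point $(x,y)$ is in $\lambda$ iff $y\le\lambda_x$. $\mu\subseteq\lambda$ means $\mu_i\le\lambda_i$ for all $i$; the boxes of $\lambda/\mu$ are those in $\lambda$ but not in $\mu$. A semistandard cylindric tableau of shape $\lambda/\mu$ is a map from boxes of $\lambda/\mu$ to a totally ordered set, weakly increasing along plane rows and strictly increasing down plane columns (for points in $\lambda/\mu$). A standard cylindric tableau uses each of $1,\dots,p$ exactly once, $p$ the number of boxes. $f_{\lambda/\mu}$ is the number of standard cylindric tableaux of shape $\lambda/\mu$. -}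

module Defs where

open import Level using (0ℓ)
open import Data.Nat using (ℕ)
open import Data.Integer using (ℤ; +_; -_; _+_; _-_; _*_; _≤_; _<_)
open import Data.Integer.Tactic.RingSolver using (solve-∀)
open import Data.Fin using (Fin)
open import Data.Product using (Σ; ∃; _×_; _,_; proj₁; proj₂)
open import Data.List using (List)
open import Data.List.Relation.Unary.All using (All)
open import Data.List.Relation.Unary.Any using (Any)
open import Data.List.Relation.Unary.AllPairs using (AllPairs)
open import Relation.Nullary using (¬_)
open import Relation.Binary.Bundles using (Setoid)
open import Relation.Binary.Structures using (IsEquivalence)
open import Relation.Binary.PropositionalEquality
  using (_≡_; refl; sym; trans; cong; cong₂; subst)
import Relation.Binary.PropositionalEquality as ≡
open import Function.Bundles using (Inverse)

HasCard : ∀ {a ℓ} → Setoid a ℓ → ℕ → Set _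
HasCard S c = Inverse S (≡.setoid (Fin c))

record CylPart (k n : ℕ) : Set where
  field
    seq        : ℤ → ℤ
    decreasing : ∀ {i j} → i ≤ j → seq j ≤ seq i
    periodic   : ∀ i → seq i ≡ seq (i + + k) + (+ n - + k)

open CylPart public

module _ {k n : ℕ} where

  _≈ₚ_ : CylPart k n → CylPart k n → Set
  μ ≈ₚ λ' = ∀ i → seq μ i ≡ seq λ' i

  _⊆_ : CylPart k n → CylPart k n → Set
  μ ⊆ λ' = ∀ i → seq μ i ≤ seq λ' i

  -- points of Z^2 : (row x, column y)
  Point : Set
  Point = ℤ × ℤ

  _∈ₚ_ : Point → CylPart k n → Set
  (x , y) ∈ₚ λ' = y ≤ seq λ' x

  InSkew : CylPart k n → CylPart k n → Point → Set
  InSkew λ' μ (x , y) = seq μ x < y × y ≤ seq λ' x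

  -- two points represent the same element of C_{k,n} = Z^2 / (-k, n-k)Z
  _∼_ : Point → Point → Set
  (x , y) ∼ (x' , y') =
    Σ ℤ λ t → (x' ≡ x + t * (- (+ k))) × (y' ≡ y + t * (+ n - + k))

  private
    lemR : ∀ a d → a ≡ a + (+ 0) * d
    lemR = solve-∀
    lemS : ∀ a t d → a ≡ (a + t * d) + (- t) * d
    lemS = solve-∀
    lemT : ∀ a t s d → (a + t * d) + s * d ≡ a + (t + s) * d
    lemT = solve-∀

  ∼-refl : ∀ {P : Point} → P ∼ P
  ∼-refl {x , y} = + 0 , lemR x (- (+ k)) , lemR y (+ n - + k)

  ∼-sym : ∀ {P Q : Point} → P ∼ Q → Q ∼ P
  ∼-sym {x , y} (t , refl , refl) = - t , lemS x t (- (+ k)) , lemS y t (+ n - + k)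

  ∼-trans : ∀ {P Q R : Point} → P ∼ Q → Q ∼ R → P ∼ R
  ∼-trans {x , y} (t , refl , refl) (s , refl , refl) =
    t + s , lemT x t s (- (+ k)) , lemT y t s (+ n - + k)

  Boxes : CylPart k n → CylPart k n → Setoid 0ℓ 0ℓ
  Boxes λ' μ = record
    { Carrier       = Σ Point (InSkew λ' μ)
    ; _≈_           = λ P Q → proj₁ P ∼ proj₁ Q
    ; isEquivalence = record
      { refl  = λ {P} → ∼-refl {proj₁ P}
      ; sym   = λ {P} {Q} → ∼-sym {proj₁ P} {proj₁ Q}
      ; trans = λ {P} {Q} {R} → ∼-trans {proj₁ P} {proj₁ Q} {proj₁ R}
      }
    }

  record SYT (λ' μ : CylPart k n) : Set where
    field
      T          : Point → ℕ
      wellDef    : ∀ P Q → InSkew λ' μ P → P ∼ Q → T P ≡ T Q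
      rowWeak    : ∀ x y y' → InSkew λ' μ (x , y) → InSkew λ' μ (x , y') →
                   y ≤ y' → Data.Nat._≤_ (T (x , y)) (T (x , y'))
      colStrict  : ∀ x x' y → InSkew λ' μ (x , y) → InSkew λ' μ (x' , y) →
                   x < x' → Data.Nat._<_ (T (x , y)) (T (x' , y))
      p          : ℕ
      numBoxes   : HasCard (Boxes λ' μ) p
      inRange    : ∀ P → InSkew λ' μ P →
                   Data.Nat._≤_ 1 (T P) × Data.Nat._≤_ (T P) p
      injective  : ∀ P Q → InSkew λ' μ P → InSkew λ' μ Q → T P ≡ T Q → P ∼ Q
      surjective : ∀ v → Data.Nat._≤_ 1 v → Data.Nat._≤_ v p →
                   Σ Point λ P → InSkew λ' μ P × T P ≡ v

  open SYT public

  SYTs : CylPart k n → CylPart k n → Setoid 0ℓ 0ℓ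
  SYTs λ' μ = record
    { Carrier       = SYT λ' μ
    ; _≈_           = λ S S' → ∀ P → InSkew λ' μ P → T S P ≡ T S' P
    ; isEquivalence = record
      { refl  = λ _ _ → refl
      ; sym   = λ e P h → sym (e P h)
      ; trans = λ e e' P h → trans (e P h) (e' P h)
      }
    }

  fIs : CylPart k n → CylPart k n → ℕ → Set
  fIs λ' μ c = HasCard (SYTs λ' μ) c

  InM : CylPart k n → ℕ → CylPart k n → Set
  InM α m μ = μ ⊆ α × HasCard (Boxes α μ) m

  InΛ : CylPart k n → ℕ → CylPart k n → Set
  InΛ α m λ' = α ⊆ λ' × HasCard (Boxes λ' α) m

  Enumerates : (CylPart k n → Set) → List (CylPart k n) → Set
  Enumerates P xs =
    All P xs × (∀ μ → P μ → Any (μ ≈ₚ_) xs) × AllPairs (λ a b → ¬ (a ≈ₚ b)) xs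

module Submission where

-- A standard tableau of shape λ/μ with p boxes amounts to a word c₁ … c_p of row classes modulo k such that
-- the corners of λ in the classes c₁, c₂, … can be removed one after the other, ending at μ; the box removed
-- at step j carries the entry p − j + 1. So the left-hand side counts the removal walks of length m from α,
-- and, reading words backwards, the right-hand side counts the addition walks of length m from α.
-- On the cylinder the corner of class c + 1 is addable exactly when the corner of class c is removable, so
-- every cylindric partition has as many addable as removable corners, and a removal and an addition in
-- distinct classes commute. Hence the down and up operators commute, DU = UD, and Dᵐ and Uᵐ count equally many
-- walks from α.

open import Level using (0ℓ)
open import Function using (_∘_; id)
open import Function.Bundles using (Inverse; Equivalence; _⇔_; mk⇔)
import Function.Construct.Composition as Comp
open import Relation.Binary.Bundles using (Setoid)
open import Relation.Binary.Definitions using (tri<; tri≈; tri>)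
open import Relation.Binary.PropositionalEquality
open import Relation.Nullary using (¬_; Dec; yes; no)
open import Relation.Nullary.Decidable using (recompute; decidable-stable)
open import Data.Empty using (⊥-elim)
open import Data.Product using (Σ; _×_; _,_; proj₁; proj₂; map₂)
open import Data.Sum using (_⊎_; inj₁; inj₂)
open import Data.Bool using (Bool; true; false) renaming (T to So; T? to So?)
open import Data.Maybe as Maybe using (Maybe; just; nothing)
open import Data.Nat as ℕ using (ℕ; zero; suc; z≤n; s≤s)
import Data.Nat.Properties as ℕP
open import Data.Nat.ListAction using (sum)
open import Data.Integer using (ℤ; +_; -[1+_]; 0ℤ; 1ℤ; -1ℤ; _+_; _-_; _*_; -_; +≤+; +<+)
import Data.Integer.Properties as ℤP
open import Data.Integer.DivMod using (_%ℕ_; _/ℕ_; a≡a%ℕn+[a/ℕn]*n; n%ℕd<d)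
open import Data.Integer.Tactic.RingSolver using (solve-∀)
open import Data.Fin as Fin using (Fin; toℕ; fromℕ<)
import Data.Fin.Properties as FinP
open import Data.List using (List; []; _∷_; _++_; _∷ʳ_; length; map; lookup; reverse; replicate)
open import Data.List using (filterᵇ; tabulate; allFin; cartesianProductWith)
import Data.List.Properties as LP
open import Data.List.Membership.Propositional using (_∈_)
open import Data.List.Membership.Propositional.Properties using (∈-lookup)
import Data.List.Membership.Propositional.Properties as MP
open import Data.List.Relation.Unary.All as All using (All)
open import Data.List.Relation.Unary.Any as Any using (Any; here; there; index)
import Data.List.Relation.Unary.Any.Properties as AnyP
open import Data.List.Relation.Unary.AllPairs using (AllPairs; []; _∷_)
open import Data.List.Relation.Unary.Unique.Propositional using (Unique)
import Data.List.Relation.Unary.Unique.Propositional.Properties as UP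
open import Algebra.Properties.CommutativeSemigroup ℕP.+-commutativeSemigroup using (interchange)
open import Algebra.Properties.Semiring.Sum ℕP.+-*-semiring
  using (sum-syntax; sum-cong-≗; ∑-comm; ∑-distrib-+; sum-remove; *-distribʳ-sum; sum-init-last; sum-replicate-zero)

open import Defs

module _ where
  open import Data.Integer using (_≤_; _<_)

  <⇒+1≤ : ∀ {a b} → a < b → a + 1ℤ ≤ b
  <⇒+1≤ {a} p = subst (_≤ _) (ℤP.+-comm 1ℤ a) (ℤP.i<j⇒suc[i]≤j p)

  +1≤⇒< : ∀ {a b} → a + 1ℤ ≤ b → a < b
  +1≤⇒< {a} p = ℤP.suc[i]≤j⇒i<j (subst (_≤ _) (ℤP.+-comm a 1ℤ) p)

  <⇒≤-1 : ∀ {a b} → a < b → a ≤ b - 1ℤ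
  <⇒≤-1 {a} {b} p = subst (_≤ b - 1ℤ) (cancel a) (ℤP.+-monoˡ-≤ (- 1ℤ) (<⇒+1≤ p))
    where
    cancel : ∀ a → a + 1ℤ - 1ℤ ≡ a
    cancel = solve-∀

  ≤-1⇒< : ∀ {a b} → a ≤ b - 1ℤ → a < b
  ≤-1⇒< {a} {b} p = +1≤⇒< (subst (a + 1ℤ ≤_) (cancel b) (ℤP.+-monoˡ-≤ 1ℤ p))
    where
    cancel : ∀ a → a - 1ℤ + 1ℤ ≡ a
    cancel = solve-∀

  i<i+1 : ∀ i → i < i + 1ℤ
  i<i+1 i = +1≤⇒< ℤP.≤-refl

  i-1<i : ∀ i → i - 1ℤ < i
  i-1<i i = ≤-1⇒< ℤP.≤-refl

  +-cancelʳ-< : ∀ {a b} c → a + c < b + c → a < b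
  +-cancelʳ-< {a} {b} c p = subst₂ _<_ (cancel a c) (cancel b c) (ℤP.+-monoˡ-< (- c) p)
    where
    cancel : ∀ x y → x + y - y ≡ x
    cancel = solve-∀

HasCard-unique : ∀ {S : Setoid 0ℓ 0ℓ} {a b} → HasCard S a → HasCard S b → a ≡ b
HasCard-unique {S} I J = FinP.cantor-schröder-bernstein (via I J) (via J I)
  where
  open Setoid S using () renaming (sym to sym′; trans to trans′)
  via : ∀ {a b} (I : HasCard S a) (J : HasCard S b) →
        ∀ {i j} → Inverse.to J (Inverse.from I i) ≡ Inverse.to J (Inverse.from I j) → i ≡ j
  via I J {i} {j} e = trans (sym (I.strictlyInverseˡ i)) (trans (I.to-cong from-i≈from-j) (I.strictlyInverseˡ j))
    where
    module I = Inverse I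
    module J = Inverse J
    from-i≈from-j =
      trans′ (sym′ (J.strictlyInverseʳ (I.from i))) (trans′ (J.from-cong e) (J.strictlyInverseʳ (I.from j)))

indicator : Bool → ℕ
indicator true = 1
indicator false = 0

module _ {A : Set} where

  Members : List A → Setoid 0ℓ 0ℓ
  Members xs = record
    { Carrier       = Σ A (_∈ xs)
    ; _≈_           = λ u v → proj₁ u ≡ proj₁ v
    ; isEquivalence = record { refl = refl ; sym = sym ; trans = trans }
    }

  private
    index-unique : ∀ {xs : List A} → Unique xs → ∀ {a b} → a ≡ b → (p : a ∈ xs) (q : b ∈ xs) →
                   index p ≡ index q
    index-unique u refl (here refl) (here refl) = refl
    index-unique (a∉ ∷ u) refl (here refl) (there q) = ⊥-elim (All.lookup a∉ q refl)
    index-unique (a∉ ∷ u) refl (there p) (here refl) = ⊥-elim (All.lookup a∉ p refl)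
    index-unique (_ ∷ u) refl (there p) (there q) = cong Fin.suc (index-unique u refl p q)

    index-∈-lookup : ∀ (xs : List A) i → index (∈-lookup {xs = xs} i) ≡ i
    index-∈-lookup (x ∷ xs) Fin.zero = refl
    index-∈-lookup (x ∷ xs) (Fin.suc i) = cong Fin.suc (index-∈-lookup xs i)

  unique⇒members-card : ∀ {xs} → Unique xs → HasCard (Members xs) (length xs)
  unique⇒members-card {xs} u = record
    { to        = λ (a , a∈) → index a∈
    ; from      = λ i → lookup xs i , ∈-lookup i
    ; to-cong   = λ {(_ , p)} {(_ , q)} e → index-unique u e p q
    ; from-cong = cong (lookup xs)
    ; inverse   = (λ {i} {(_ , p)} e → trans (index-unique u e p (∈-lookup i)) (index-∈-lookup xs i))
                , (λ {(_ , p)} e → trans (cong (lookup xs) e) (sym (AnyP.lookup-index p)))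
    }

  count : (A → Bool) → List A → ℕ
  count P xs = length (filterᵇ P xs)

  count-∷ : ∀ P x xs → count P (x ∷ xs) ≡ indicator (P x) ℕ.+ count P xs
  count-∷ P x xs with P x
  ... | true = refl
  ... | false = refl

  count-++ : ∀ P xs ys → count P (xs ++ ys) ≡ count P xs ℕ.+ count P ys
  count-++ P xs ys = trans (cong length (LP.filter-++ (So? ∘ P) xs ys)) (LP.length-++ (filterᵇ P xs))

  count-none : ∀ xs → count (λ _ → false) xs ≡ 0
  count-none [] = refl
  count-none (x ∷ xs) = count-none xs

count-map : ∀ {A B : Set} (P : B → Bool) (f : A → B) xs → count P (map f xs) ≡ count (P ∘ f) xs
count-map P f [] = refl
count-map P f (x ∷ xs) = trans (count-∷ P (f x) (map f xs))
  (trans (cong (indicator (P (f x)) ℕ.+_) (count-map P f xs)) (sym (count-∷ (P ∘ f) x xs)))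

count-cartesian : ∀ {A : Set} {j} (g : Fin j → A) (ys : List (List A)) (P : List A → Bool) →
                  count P (cartesianProductWith _∷_ (tabulate g) ys) ≡ ∑[ c < j ] count (λ w → P (g c ∷ w)) ys
count-cartesian {j = zero} g ys P = refl
count-cartesian {j = suc j} g ys P = trans (count-++ P (map (g Fin.zero ∷_) ys) _)
  (cong₂ ℕ._+_ (count-map P (g Fin.zero ∷_) ys) (count-cartesian (g ∘ Fin.suc) ys P))

words : ∀ j → ℕ → List (List (Fin j))
words j zero = [] ∷ []
words j (suc m) = cartesianProductWith _∷_ (allFin j) (words j m)

module _ {j : ℕ} where

  ∈-words⁻ : ∀ m {w} → w ∈ words j m → length w ≡ m
  ∈-words⁻ zero (here refl) = refl
  ∈-words⁻ (suc m) w∈ with MP.∈-cartesianProductWith⁻ _∷_ (allFin j) (words j m) w∈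
  ... | _ , _ , _ , w′∈ , refl = cong suc (∈-words⁻ m w′∈)

  ∈-words⁺ : ∀ (w : List (Fin j)) → w ∈ words j (length w)
  ∈-words⁺ [] = here refl
  ∈-words⁺ (c ∷ w) = MP.∈-cartesianProductWith⁺ _∷_ (MP.∈-allFin c) (∈-words⁺ w)

  words-unique : ∀ m → Unique (words j m)
  words-unique zero = All.[] ∷ []
  words-unique (suc m) = UP.cartesianProductWith⁺ _∷_ LP.∷-injective (UP.allFin⁺ j) (words-unique m)

module _ {B : Set} where

  sum-map-cong : ∀ {P : B → Set} {f g : B → ℕ} {xs} → All P xs → (∀ {b} → P b → f b ≡ g b) →
                 sum (map f xs) ≡ sum (map g xs)
  sum-map-cong All.[] f≡g = refl
  sum-map-cong (pb All.∷ pbs) f≡g = cong₂ ℕ._+_ (f≡g pb) (sum-map-cong pbs f≡g)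

  sum-map-+ : ∀ (f g : B → ℕ) xs → sum (map (λ b → f b ℕ.+ g b) xs) ≡ sum (map f xs) ℕ.+ sum (map g xs)
  sum-map-+ f g [] = refl
  sum-map-+ f g (b ∷ xs) = trans (cong (f b ℕ.+ g b ℕ.+_) (sum-map-+ f g xs)) (interchange (f b) (g b) _ _)

  sum-map-zero : ∀ xs → sum (map (λ (_ : B) → 0) xs) ≡ 0
  sum-map-zero [] = refl
  sum-map-zero (_ ∷ xs) = sum-map-zero xs

  sum-count : ∀ {A : Set} (Ms : List B) (E : B → A → Bool) (V : A → Bool) (W : List A) →
              (∀ w → w ∈ W → sum (map (λ μ → indicator (E μ w)) Ms) ≡ indicator (V w)) →
              sum (map (λ μ → count (E μ) W) Ms) ≡ count V W
  sum-count Ms E V [] matched = sum-map-zero Ms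
  sum-count Ms E V (w ∷ W) matched = begin
      sum (map (λ μ → count (E μ) (w ∷ W)) Ms)
    ≡⟨ cong sum (LP.map-cong (λ μ → count-∷ (E μ) w W) Ms) ⟩
      sum (map (λ μ → indicator (E μ w) ℕ.+ count (E μ) W) Ms)
    ≡⟨ sum-map-+ (λ μ → indicator (E μ w)) (λ μ → count (E μ) W) Ms ⟩
      sum (map (λ μ → indicator (E μ w)) Ms) ℕ.+ sum (map (λ μ → count (E μ) W) Ms)
    ≡⟨ cong₂ ℕ._+_ (matched w (here refl)) (sum-count Ms E V W (λ w′ w′∈ → matched w′ (there w′∈))) ⟩
      indicator (V w) ℕ.+ count V W
    ≡⟨ count-∷ V w W ⟨
      count V (w ∷ W) ∎
    where
    open ≡-Reasoning

module Residue (k′ : ℕ) where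

  open import Data.Integer using (_≤_; _<_)

  k : ℕ
  k = suc k′

  K : ℤ
  K = + k

  row : ℤ → ℕ
  row x = x %ℕ k

  quo : ℤ → ℤ
  quo x = x /ℕ k

  row<k : ∀ x → row x ℕ.< k
  row<k x = n%ℕd<d x k

  row+quo : ∀ x → x ≡ + row x + quo x * K
  row+quo x = a≡a%ℕn+[a/ℕn]*n x k

  private
    move-quotients : ∀ r r′ t t′ → r + t * K ≡ r′ + t′ * K → r ≡ r′ + (t′ - t) * K
    move-quotients r r′ t t′ e = trans (lhs r t K) (trans (cong (_- t * K) e) (rhs r′ t′ t K))
      where
      lhs : ∀ r t K → r ≡ r + t * K - t * K
      lhs = solve-∀
      rhs : ∀ r′ t′ t K → r′ + t′ * K - t * K ≡ r′ + (t′ - t) * K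
      rhs = solve-∀

  -- r = r′ + s K with s = t′ − t; s ≥ 1 would force r ≥ K and s ≤ −1 would force r < 0.
  division-unique : ∀ {r r′} t t′ → r ℕ.< k → r′ ℕ.< k → + r + t * K ≡ + r′ + t′ * K → r ≡ r′
  division-unique {r} {r′} t t′ r<k r′<k e with ℤP.<-cmp (t′ - t) 0ℤ
  ... | tri≈ _ s≡0 _ = ℤP.+-injective (trans r≡ (trans (cong (λ s → + r′ + s * K) s≡0) (zero-multiple (+ r′) K)))
    where
    r≡ = move-quotients (+ r) (+ r′) t t′ e
    zero-multiple : ∀ a K → a + 0ℤ * K ≡ a
    zero-multiple = solve-∀
  ... | tri> _ _ s>0 = ⊥-elim (ℤP.<-irrefl refl (ℤP.<-≤-trans (+<+ r<k) K≤r))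
    where
    one-multiple : ∀ K → 0ℤ + 1ℤ * K ≡ K
    one-multiple = solve-∀
    K≤r : K ≤ + r
    K≤r = subst₂ _≤_ (one-multiple K) (sym (move-quotients (+ r) (+ r′) t t′ e))
            (ℤP.+-mono-≤ (+≤+ z≤n) (ℤP.*-monoʳ-≤-nonNeg K (ℤP.i<j⇒suc[i]≤j s>0)))
  ... | tri< s<0 _ _ = ⊥-elim (ℤP.<-irrefl refl (ℤP.≤-<-trans (+≤+ z≤n) (ℤP.≤-<-trans r≤ r′-K<0)))
    where
    minus-multiple : ∀ a K → a + -1ℤ * K ≡ a - K
    minus-multiple = solve-∀
    r≤ : + r ≤ + r′ - K
    r≤ = subst₂ _≤_ (sym (move-quotients (+ r) (+ r′) t t′ e)) (minus-multiple (+ r′) K)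
           (ℤP.+-monoʳ-≤ (+ r′) (ℤP.*-monoʳ-≤-nonNeg K (ℤP.i<j⇒i≤pred[j] s<0)))
    r′-K<0 : + r′ - K < 0ℤ
    r′-K<0 = subst (+ r′ - K <_) (ℤP.+-inverseʳ K) (ℤP.+-monoˡ-< (- K) (+<+ r′<k))

  row-of-representative : ∀ r t → r ℕ.< k → row (+ r + t * K) ≡ r
  row-of-representative r t r<k = sym (division-unique t (quo x) r<k (row<k x) (row+quo x))
    where
    x = + r + t * K

  row-+-multiple : ∀ x t → row (x + t * K) ≡ row x
  row-+-multiple x t = trans (cong row regroup) (row-of-representative (row x) (quo x + t) (row<k x))
    where
    regroup : x + t * K ≡ + row x + (quo x + t) * K
    regroup = trans (cong (_+ t * K) (row+quo x)) (distrib (+ row x) (quo x) t K)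
      where
      distrib : ∀ a q t K → a + q * K + t * K ≡ a + (q + t) * K
      distrib = solve-∀

module Cylinder (k′ n : ℕ) (k<n : suc k′ ℕ.< n) where

  open Residue k′ public
  open import Data.Integer using (_≤_; _<_)

  CP : Set
  CP = CylPart k n

  Pt : Set
  Pt = Point {k} {n}

  infix 4 _≡ᶜ_ _≐_

  _≡ᶜ_ : Pt → Pt → Set
  P ≡ᶜ Q = _∼_ {k} {n} P Q

  ≡ᶜ-refl : ∀ {P} → P ≡ᶜ P
  ≡ᶜ-refl {P} = ∼-refl {k} {n} {P}

  ≡ᶜ-sym : ∀ {P Q} → P ≡ᶜ Q → Q ≡ᶜ P
  ≡ᶜ-sym {P} {Q} = ∼-sym {k} {n} {P} {Q}

  ≡ᶜ-trans : ∀ {P Q R} → P ≡ᶜ Q → Q ≡ᶜ R → P ≡ᶜ R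
  ≡ᶜ-trans {P} {Q} {R} = ∼-trans {k} {n} {P} {Q} {R}

  _≐_ : CP → CP → Set
  _≐_ = _≈ₚ_

  ≐-sym : ∀ {a b} → a ≐ b → b ≐ a
  ≐-sym e i = sym (e i)

  ≐-trans : ∀ {a b c} → a ≐ b → b ≐ c → a ≐ c
  ≐-trans e e′ i = trans (e i) (e′ i)

  D : ℤ
  D = + n - K

  0<D : 0ℤ < D
  0<D = subst (_< D) (ℤP.+-inverseʳ K) (ℤP.+-monoˡ-< (- K) (+<+ k<n))

  seq-+-periods : (s : CP) → ∀ x m → seq s (x + + m * K) ≡ seq s x - + m * D
  seq-+-periods s x zero = trans (cong (seq s) (no-shift x K)) (sym (no-shift (seq s x) D))
    where
    no-shift : ∀ a b → a + 0ℤ * b ≡ a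
    no-shift = solve-∀
  seq-+-periods s x (suc m) = begin
      seq s (x + + suc m * K)         ≡⟨ cong (seq s) (one-more x (+ m) K) ⟩
      seq s (x + + m * K + K)         ≡⟨ add-sub (seq s (x + + m * K + K)) D ⟩
      seq s (x + + m * K + K) + D - D ≡⟨ cong (_- D) (periodic s (x + + m * K)) ⟨
      seq s (x + + m * K) - D         ≡⟨ cong (_- D) (seq-+-periods s x m) ⟩
      seq s x - + m * D - D           ≡⟨ one-less (seq s x) (+ m) D ⟩
      seq s x - + suc m * D           ∎
    where
    open ≡-Reasoning
    one-more : ∀ x m K → x + (1ℤ + m) * K ≡ x + m * K + K
    one-more = solve-∀
    add-sub : ∀ a D → a ≡ a + D - D
    add-sub = solve-∀
    one-less : ∀ a m D → a - m * D - D ≡ a - (1ℤ + m) * D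
    one-less = solve-∀

  seq-+-multiple : (s : CP) → ∀ x t → seq s (x + t * K) ≡ seq s x - t * D
  seq-+-multiple s x (+ m) = seq-+-periods s x m
  seq-+-multiple s x t@(-[1+ m ]) = begin
      seq s (x + t * K)                                   ≡⟨ add-sub (seq s (x + t * K)) (+ suc m * D) ⟩
      seq s (x + t * K) - + suc m * D + + suc m * D       ≡⟨ cong (_+ + suc m * D) (seq-+-periods s (x + t * K) (suc m)) ⟨
      seq s (x + t * K + + suc m * K) + + suc m * D       ≡⟨ cong (λ z → seq s z + + suc m * D) (back x (+ suc m) K) ⟩
      seq s x + + suc m * D                               ≡⟨ negate (seq s x) (+ suc m) D ⟩
      seq s x - t * D                                     ∎
    where
    open ≡-Reasoning
    add-sub : ∀ a b → a ≡ a - b + b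
    add-sub = solve-∀
    back : ∀ x m K → x + (- m) * K + m * K ≡ x
    back = solve-∀
    negate : ∀ a m D → a + m * D ≡ a - (- m) * D
    negate = solve-∀

  ∈-resp-≡ᶜ : (s : CP) → ∀ {P Q} → P ≡ᶜ Q → P ∈ₚ s → Q ∈ₚ s
  ∈-resp-≡ᶜ s {x , y} (t , refl , refl) y≤sx =
    subst (y + t * D ≤_) (sym shifted) (ℤP.+-monoˡ-≤ (t * D) y≤sx)
    where
    reorient : ∀ x t K → x + t * (- K) ≡ x + (- t) * K
    reorient = solve-∀
    negate : ∀ a t D → a - (- t) * D ≡ a + t * D
    negate = solve-∀
    shifted : seq s (x + t * (- K)) ≡ seq s x + t * D
    shifted = trans (cong (seq s) (reorient x t K)) (trans (seq-+-multiple s x (- t)) (negate (seq s x) t D))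

  ∉-resp-≡ᶜ : (s : CP) → ∀ {P Q} → P ≡ᶜ Q → ¬ P ∈ₚ s → ¬ Q ∈ₚ s
  ∉-resp-≡ᶜ s {P} {Q} e P∉s Q∈s = P∉s (∈-resp-≡ᶜ s (≡ᶜ-sym {P} {Q} e) Q∈s)

  private
    no-zero-divisor : ∀ t {a} → ¬ a ≡ 0ℤ → t * a ≡ 0ℤ → t ≡ 0ℤ
    no-zero-divisor t a≢0 e with ℤP.i*j≡0⇒i≡0∨j≡0 t e
    ... | inj₁ t≡0 = t≡0
    ... | inj₂ a≡0 = ⊥-elim (a≢0 a≡0)

    difference-zero : ∀ {x a} → x ≡ x + a → a ≡ 0ℤ
    difference-zero {x} {a} e = trans (add-sub x a) (trans (cong (_- x) (sym e)) (ℤP.+-inverseʳ x))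
      where
      add-sub : ∀ x a → a ≡ x + a - x
      add-sub = solve-∀

    times-zero : ∀ a b → a + 0ℤ * b ≡ a
    times-zero = solve-∀

  -- The identification shifts rows by multiples of K and columns by multiples of D, both nonzero.
  ≡ᶜ-in-row⇒≡ : ∀ {x y y′} → (x , y) ≡ᶜ (x , y′) → y ≡ y′
  ≡ᶜ-in-row⇒≡ {x} {y} (t , ex , ey) = sym (trans ey (trans (cong (λ t → y + t * D) t≡0) (times-zero y D)))
    where
    t≡0 = no-zero-divisor t {a = - K} (λ ()) (difference-zero ex)

  ≡ᶜ-in-column⇒≡ : ∀ {x x′ y} → (x , y) ≡ᶜ (x′ , y) → x ≡ x′
  ≡ᶜ-in-column⇒≡ {x} {y = y} (t , ex , ey) =
    sym (trans ex (trans (cong (λ t → x + t * (- K)) t≡0) (times-zero x (- K))))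
    where
    t≡0 = no-zero-divisor t {D} (λ D≡0 → ℤP.<-irrefl (sym D≡0) 0<D) (difference-zero ey)

  ≡ᶜ⇒row≡ : ∀ {x y x′ y′} → (x , y) ≡ᶜ (x′ , y′) → row x′ ≡ row x
  ≡ᶜ⇒row≡ {x} (t , refl , _) = trans (cong row (reorient x t K)) (row-+-multiple x (- t))
    where
    reorient : ∀ x t K → x + t * (- K) ≡ x + (- t) * K
    reorient = solve-∀

  ρ : Fin k → ℤ
  ρ c = + toℕ c

  row-ρ : ∀ c → row (ρ c) ≡ toℕ c
  row-ρ c = trans (cong row (sym (times-zero (ρ c) K))) (row-of-representative (toℕ c) 0ℤ (FinP.toℕ<n c))

  ρ-row : ∀ x {c} → row x ≡ toℕ c → x ≡ ρ c + quo x * K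
  ρ-row x e = trans (row+quo x) (cong (λ r → + r + quo x * K) e)

  δ : Fin k → ℤ → ℤ
  δ c i with row i ℕ.≟ toℕ c
  ... | yes _ = 1ℤ
  ... | no _ = 0ℤ

  δ-cases : ∀ c i → (row i ≡ toℕ c × δ c i ≡ 1ℤ) ⊎ (¬ row i ≡ toℕ c × δ c i ≡ 0ℤ)
  δ-cases c i with row i ℕ.≟ toℕ c
  ... | yes e = inj₁ (e , refl)
  ... | no ne = inj₂ (ne , refl)

  δ-≡1 : ∀ c {i} → row i ≡ toℕ c → δ c i ≡ 1ℤ
  δ-≡1 c {i} e with δ-cases c i
  ... | inj₁ (_ , δ≡1) = δ≡1
  ... | inj₂ (ne , _) = ⊥-elim (ne e)

  δ-≡0 : ∀ c {i} → ¬ row i ≡ toℕ c → δ c i ≡ 0ℤ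
  δ-≡0 c {i} ne with δ-cases c i
  ... | inj₁ (e , _) = ⊥-elim (ne e)
  ... | inj₂ (_ , δ≡0) = δ≡0

  δ-ρ : ∀ c → δ c (ρ c) ≡ 1ℤ
  δ-ρ c = δ-≡1 c (row-ρ c)

  δ-ρ-other : ∀ {c d} → ¬ c ≡ d → δ c (ρ d) ≡ 0ℤ
  δ-ρ-other {c} {d} c≢d = δ-≡0 c (λ e → c≢d (FinP.toℕ-injective (trans (sym e) (row-ρ d))))

  δ-resp-row : ∀ c {i j} → row i ≡ row j → δ c i ≡ δ c j
  δ-resp-row c {i} {j} e with δ-cases c i | δ-cases c j
  ... | inj₁ (_ , δi) | inj₁ (_ , δj) = trans δi (sym δj)
  ... | inj₂ (_ , δi) | inj₂ (_ , δj) = trans δi (sym δj)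
  ... | inj₁ (ri , _) | inj₂ (rj , _) = ⊥-elim (rj (trans (sym e) ri))
  ... | inj₂ (ri , _) | inj₁ (rj , _) = ⊥-elim (ri (trans e rj))

  δ-+K : ∀ c i → δ c (i + K) ≡ δ c i
  δ-+K c i = δ-resp-row c (trans (cong row (one-multiple i K)) (row-+-multiple i 1ℤ))
    where
    one-multiple : ∀ i K → i + K ≡ i + 1ℤ * K
    one-multiple = solve-∀

  Removable : CP → Fin k → Set
  Removable s c = seq s (ρ c + 1ℤ) < seq s (ρ c)

  Addable : CP → Fin k → Set
  Addable s c = seq s (ρ c) < seq s (ρ c - 1ℤ)

  removable? : ∀ s c → Dec (Removable s c)
  removable? s c = seq s (ρ c + 1ℤ) ℤP.<? seq s (ρ c)

  addable? : ∀ s c → Dec (Addable s c)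
  addable? s c = seq s (ρ c) ℤP.<? seq s (ρ c - 1ℤ)

  <-+-multiple : (s : CP) → ∀ {a b} q → seq s a < seq s b → seq s (a + q * K) < seq s (b + q * K)
  <-+-multiple s {a} {b} q p =
    subst₂ _<_ (sym (seq-+-multiple s a q)) (sym (seq-+-multiple s b q)) (ℤP.+-monoˡ-< (- (q * D)) p)

  private
    move-multiple : ∀ a q K b → a + q * K + b ≡ a + b + q * K
    move-multiple = solve-∀

  removable-in-class : (s : CP) (c : Fin k) → Removable s c → ∀ {i} → row i ≡ toℕ c → seq s (i + 1ℤ) < seq s i
  removable-in-class s c r {i} e = subst₂ (λ a b → seq s a < seq s b) (sym i+1≡) (sym i≡) (<-+-multiple s (quo i) r)
    where
    i≡ = ρ-row i e
    i+1≡ : i + 1ℤ ≡ ρ c + 1ℤ + quo i * K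
    i+1≡ = trans (cong (_+ 1ℤ) i≡) (move-multiple (ρ c) (quo i) K 1ℤ)

  addable-in-class : (s : CP) (c : Fin k) → Addable s c → ∀ {i} → row i ≡ toℕ c → seq s i < seq s (i - 1ℤ)
  addable-in-class s c a {i} e = subst₂ (λ a b → seq s a < seq s b) (sym i≡) (sym i-1≡) (<-+-multiple s (quo i) a)
    where
    i≡ = ρ-row i e
    i-1≡ : i - 1ℤ ≡ ρ c - 1ℤ + quo i * K
    i-1≡ = trans (cong (_- 1ℤ) i≡) (move-multiple (ρ c) (quo i) K (- 1ℤ))

  removable-from-class : (s : CP) (c : Fin k) → ∀ {i} → row i ≡ toℕ c → seq s (i + 1ℤ) < seq s i → Removable s c
  removable-from-class s c {i} e p = subst₂ (λ a b → seq s a < seq s b) i+1↦ i↦ (<-+-multiple s (- quo i) p)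
    where
    i↦ : i + (- quo i) * K ≡ ρ c
    i↦ = trans (cong (_+ (- quo i) * K) (ρ-row i e)) (cancel (ρ c) (quo i) K)
      where
      cancel : ∀ a q K → a + q * K + (- q) * K ≡ a
      cancel = solve-∀
    i+1↦ : i + 1ℤ + (- quo i) * K ≡ ρ c + 1ℤ
    i+1↦ = trans (cong (λ z → z + 1ℤ + (- quo i) * K) (ρ-row i e)) (cancel (ρ c) (quo i) K)
      where
      cancel : ∀ a q K → a + q * K + 1ℤ + (- q) * K ≡ a + 1ℤ
      cancel = solve-∀

  private
    rows-differ : ∀ {i j} → ¬ row i ≡ row j → ¬ i ≡ j
    rows-differ ne refl = ne refl

    ≤∧≢⇒+1≤ : ∀ {i j} → i ≤ j → ¬ i ≡ j → i + 1ℤ ≤ j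
    ≤∧≢⇒+1≤ i≤j i≢j = <⇒+1≤ (ℤP.≤∧≢⇒< i≤j i≢j)

    ≤∧≢⇒≤-1 : ∀ {i j} → i ≤ j → ¬ i ≡ j → i ≤ j - 1ℤ
    ≤∧≢⇒≤-1 i≤j i≢j = <⇒≤-1 (ℤP.≤∧≢⇒< i≤j i≢j)

  removeCorner-decreasing : (s : CP) (c : Fin k) → Removable s c →
                            ∀ {i j} → i ≤ j → seq s j - δ c j ≤ seq s i - δ c i
  removeCorner-decreasing s c r {i} {j} i≤j with row i ℕ.≟ toℕ c | row j ℕ.≟ toℕ c
  ... | yes _ | yes _ = ℤP.+-monoˡ-≤ (- 1ℤ) (decreasing s i≤j)
  ... | no _ | no _ = ℤP.+-monoˡ-≤ 0ℤ (decreasing s i≤j)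
  ... | no _ | yes _ =
    ℤP.≤-trans (ℤP.<⇒≤ (i-1<i (seq s j)))
               (ℤP.≤-trans (decreasing s i≤j) (ℤP.≤-reflexive (sym (ℤP.+-identityʳ (seq s i)))))
  ... | yes ri | no rj = subst (_≤ seq s i - 1ℤ) (sym (ℤP.+-identityʳ (seq s j)))
    (<⇒≤-1 (ℤP.≤-<-trans (decreasing s (≤∧≢⇒+1≤ i≤j i≢j)) (removable-in-class s c r ri)))
    where
    i≢j = rows-differ (λ e → rj (trans (sym e) ri))

  addCorner-decreasing : (s : CP) (c : Fin k) → Addable s c →
                         ∀ {i j} → i ≤ j → seq s j + δ c j ≤ seq s i + δ c i
  addCorner-decreasing s c a {i} {j} i≤j with row i ℕ.≟ toℕ c | row j ℕ.≟ toℕ c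
  ... | yes _ | yes _ = ℤP.+-monoˡ-≤ 1ℤ (decreasing s i≤j)
  ... | no _ | no _ = ℤP.+-monoˡ-≤ 0ℤ (decreasing s i≤j)
  ... | yes _ | no _ =
    ℤP.≤-trans (ℤP.≤-reflexive (ℤP.+-identityʳ (seq s j)))
               (ℤP.≤-trans (decreasing s i≤j) (ℤP.<⇒≤ (i<i+1 (seq s i))))
  ... | no ri | yes rj = subst (seq s j + 1ℤ ≤_) (sym (ℤP.+-identityʳ (seq s i)))
    (<⇒+1≤ (ℤP.<-≤-trans (addable-in-class s c a rj) (decreasing s (≤∧≢⇒≤-1 i≤j i≢j))))
    where
    i≢j = rows-differ (λ e → ri (trans e rj))

  periodic-+ : (s : CP) (d : ℤ → ℤ) → (∀ i → d (i + K) ≡ d i) →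
               ∀ i → seq s i + d i ≡ seq s (i + K) + d (i + K) + D
  periodic-+ s d d-periodic i = begin
      seq s i + d i                    ≡⟨ cong (_+ d i) (periodic s i) ⟩
      seq s (i + K) + D + d i          ≡⟨ swap (seq s (i + K)) D (d i) ⟩
      seq s (i + K) + d i + D          ≡⟨ cong (λ z → seq s (i + K) + z + D) (d-periodic i) ⟨
      seq s (i + K) + d (i + K) + D    ∎
    where
    open ≡-Reasoning
    swap : ∀ a D x → a + D + x ≡ a + x + D
    swap = solve-∀

  removeCorner : (s : CP) (c : Fin k) → .(Removable s c) → CP
  removeCorner s c r = record
    { seq        = λ i → seq s i - δ c i
    ; decreasing = removeCorner-decreasing s c (recompute (removable? s c) r)
    ; periodic   = periodic-+ s (λ i → - δ c i) (λ i → cong -_ (δ-+K c i))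
    }

  addCorner : (s : CP) (c : Fin k) → .(Addable s c) → CP
  addCorner s c a = record
    { seq        = λ i → seq s i + δ c i
    ; decreasing = addCorner-decreasing s c (recompute (addable? s c) a)
    ; periodic   = periodic-+ s (δ c) (δ-+K c)
    }

  corner : CP → Fin k → Pt
  corner s c = ρ c , seq s (ρ c)

  corner-∈ : (s : CP) (c : Fin k) → corner s c ∈ₚ s
  corner-∈ s c = ℤP.≤-refl

  corner-∉-removeCorner : (s : CP) (c : Fin k) .(r : Removable s c) → ¬ corner s c ∈ₚ removeCorner s c r
  corner-∉-removeCorner s c r p =
    ℤP.<-irrefl refl (ℤP.<-≤-trans (i-1<i (seq s (ρ c))) (subst (λ d → seq s (ρ c) ≤ seq s (ρ c) - d) (δ-ρ c) p))

  removeCorner-⊆ : (s : CP) (c : Fin k) .(r : Removable s c) → ∀ {P} → P ∈ₚ removeCorner s c r → P ∈ₚ s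
  removeCorner-⊆ s c r {x , y} p with row x ℕ.≟ toℕ c
  ... | yes _ = ℤP.≤-trans p (ℤP.<⇒≤ (i-1<i (seq s x)))
  ... | no _ = subst (y ≤_) (ℤP.+-identityʳ (seq s x)) p

  -- A box of s missing from removeCorner s c is the last box of a row of class c, hence a translate of the corner.
  removed-≡ᶜ-corner : (s : CP) (c : Fin k) .(r : Removable s c) →
                      ∀ {P} → P ∈ₚ s → ¬ P ∈ₚ removeCorner s c r → corner s c ≡ᶜ P
  removed-≡ᶜ-corner s c r {x , y} p np with row x ℕ.≟ toℕ c
  ... | no _ = ⊥-elim (np (subst (y ≤_) (sym (ℤP.+-identityʳ (seq s x))) p))
  ... | yes e = - quo x , x≡ , y≡
    where
    negate-both : ∀ a q K → a + q * K ≡ a + (- q) * (- K)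
    negate-both = solve-∀
    x≡ : x ≡ ρ c + (- quo x) * (- K)
    x≡ = trans (ρ-row x e) (negate-both (ρ c) (quo x) K)
    negate-left : ∀ a q D → a - q * D ≡ a + (- q) * D
    negate-left = solve-∀
    y≡sx : y ≡ seq s x
    y≡sx = ℤP.≤-antisym p (subst (_≤ y) (cancel (seq s x)) (<⇒+1≤ (ℤP.≰⇒> np)))
      where
      cancel : ∀ a → a - 1ℤ + 1ℤ ≡ a
      cancel = solve-∀
    y≡ : y ≡ seq s (ρ c) + (- quo x) * D
    y≡ = trans y≡sx (trans (cong (seq s) (ρ-row x e))
           (trans (seq-+-multiple s (ρ c) (quo x)) (negate-left (seq s (ρ c)) (quo x) D)))

  seq-<-in-class : (s : CP) → ∀ {x x′} → row x ≡ row x′ → x < x′ → seq s x′ < seq s x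
  seq-<-in-class s {x} {x′} e x<x′ =
    subst₂ _<_ (sym s-x′) (sym s-x) (ℤP.+-monoʳ-< (seq s (+ r)) (ℤP.neg-mono-< qD<q′D))
    where
    r = row x
    x′≡ : x′ ≡ + r + quo x′ * K
    x′≡ = trans (row+quo x′) (cong (λ r → + r + quo x′ * K) (sym e))
    s-x : seq s x ≡ seq s (+ r) - quo x * D
    s-x = trans (cong (seq s) (row+quo x)) (seq-+-multiple s (+ r) (quo x))
    s-x′ : seq s x′ ≡ seq s (+ r) - quo x′ * D
    s-x′ = trans (cong (seq s) x′≡) (seq-+-multiple s (+ r) (quo x′))
    swap : ∀ a q K → a + q * K ≡ q * K + a
    swap = solve-∀
    q<q′ : quo x < quo x′
    q<q′ = ℤP.*-cancelʳ-<-nonNeg K (+-cancelʳ-< (+ r)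
             (subst₂ _<_ (trans (row+quo x) (swap (+ r) (quo x) K)) (trans x′≡ (swap (+ r) (quo x′) K)) x<x′))
    qD<q′D : quo x * D < quo x′ * D
    qD<q′D with D | 0<D
    ... | + zero | +<+ ()
    ... | + suc d | _ = ℤP.*-monoʳ-<-pos (+ suc d) q<q′

  -- When k = 1 the rows ρ c and ρ c + 1 lie in the same class, and the strict decrease between them takes over.
  addCorner-removable : (s : CP) (c : Fin k) .(a : Addable s c) → Removable (addCorner s c a) c
  addCorner-removable s c a with δ-cases c (ρ c + 1ℤ)
  ... | inj₁ (e , δ≡1) = subst₂ (λ d d′ → seq s (ρ c + 1ℤ) + d < seq s (ρ c) + d′) (sym δ≡1) (sym (δ-ρ c))
      (ℤP.+-monoˡ-< 1ℤ (seq-<-in-class s (trans (row-ρ c) (sym e)) (i<i+1 (ρ c))))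
  ... | inj₂ (_ , δ≡0) = subst₂ (λ d d′ → seq s (ρ c + 1ℤ) + d < seq s (ρ c) + d′) (sym δ≡0) (sym (δ-ρ c))
      (ℤP.≤-<-trans (ℤP.≤-reflexive (ℤP.+-identityʳ _))
                    (ℤP.≤-<-trans (decreasing s (ℤP.<⇒≤ (i<i+1 (ρ c)))) (i<i+1 (seq s (ρ c)))))

  removeCorner-addable : (s : CP) (c : Fin k) .(r : Removable s c) → Addable (removeCorner s c r) c
  removeCorner-addable s c r with δ-cases c (ρ c - 1ℤ)
  ... | inj₁ (e , δ≡1) = subst₂ (λ d d′ → seq s (ρ c) - d < seq s (ρ c - 1ℤ) - d′) (sym (δ-ρ c)) (sym δ≡1)
      (ℤP.+-monoˡ-< (- 1ℤ) (seq-<-in-class s (trans e (sym (row-ρ c))) (i-1<i (ρ c))))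
  ... | inj₂ (_ , δ≡0) = subst₂ (λ d d′ → seq s (ρ c) - d < seq s (ρ c - 1ℤ) - d′) (sym (δ-ρ c)) (sym δ≡0)
      (ℤP.<-≤-trans (i-1<i (seq s (ρ c)))
                    (ℤP.≤-trans (decreasing s (ℤP.<⇒≤ (i-1<i (ρ c)))) (ℤP.≤-reflexive (sym (ℤP.+-identityʳ _)))))

  removeCorner-addCorner : (s : CP) (c : Fin k) .(a : Addable s c) .(r : Removable (addCorner s c a) c) →
                           removeCorner (addCorner s c a) c r ≐ s
  removeCorner-addCorner s c a r i = cancel (seq s i) (δ c i)
    where
    cancel : ∀ a d → a + d - d ≡ a
    cancel = solve-∀

  addCorner-removeCorner : (s : CP) (c : Fin k) .(r : Removable s c) .(a : Addable (removeCorner s c r) c) →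
                           addCorner (removeCorner s c r) c a ≐ s
  addCorner-removeCorner s c r a i = cancel (seq s i) (δ c i)
    where
    cancel : ∀ a d → a - d + d ≡ a
    cancel = solve-∀

  data Move : Set where
    down up : Move

  Corner : Move → CP → Fin k → Set
  Corner down = Removable
  Corner up = Addable

  corner? : ∀ mv s c → Dec (Corner mv s c)
  corner? down = removable?
  corner? up = addable?

  move : ∀ mv (s : CP) c → .(Corner mv s c) → CP
  move down = removeCorner
  move up = addCorner

  Corner-resp-≐ : ∀ mv {s s′} → s ≐ s′ → ∀ c → Corner mv s c → Corner mv s′ c
  Corner-resp-≐ down e c = subst₂ _<_ (e _) (e _)
  Corner-resp-≐ up e c = subst₂ _<_ (e _) (e _)

  move-cong : ∀ mv {s s′} → s ≐ s′ → ∀ c .(h : Corner mv s c) .(h′ : Corner mv s′ c) →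
              move mv s c h ≐ move mv s′ c h′
  move-cong down e c _ _ i = cong (_- δ c i) (e i)
  move-cong up e c _ _ i = cong (_+ δ c i) (e i)

  run : Move → CP → List (Fin k) → Maybe CP
  run mv s [] = just s
  run mv s (c ∷ w) with corner? mv s c
  ... | yes h = run mv (move mv s c h) w
  ... | no _ = nothing

  run-tail : ∀ mv s c w {ν} → run mv s (c ∷ w) ≡ just ν → (h : Corner mv s c) → run mv (move mv s c h) w ≡ just ν
  run-tail mv s c w eq h with corner? mv s c
  ... | yes _ = eq

  Reaches : Move → CP → List (Fin k) → CP → Set
  Reaches mv s w μ = Σ CP λ ν → run mv s w ≡ just ν × ν ≐ μ

  opposite : Move → Move
  opposite down = up
  opposite up = down

  opposite-corner : ∀ mv s c .(h : Corner mv s c) → Corner (opposite mv) (move mv s c h) c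
  opposite-corner down = removeCorner-addable
  opposite-corner up = addCorner-removable

  move-opposite : ∀ mv s c .(h : Corner mv s c) .(h′ : Corner (opposite mv) (move mv s c h) c) →
                  move (opposite mv) (move mv s c h) c h′ ≐ s
  move-opposite down = addCorner-removeCorner
  move-opposite up = removeCorner-addCorner

  run-++ : ∀ mv s w₁ w₂ → run mv s (w₁ ++ w₂) ≡ (run mv s w₁ Maybe.>>= λ t → run mv t w₂)
  run-++ mv s [] w₂ = refl
  run-++ mv s (c ∷ w₁) w₂ with corner? mv s c
  ... | yes h = run-++ mv (move mv s c h) w₁ w₂
  ... | no _ = refl

  run-single : ∀ mv t c (h : Corner mv t c) → run mv t (c ∷ []) ≡ just (move mv t c h)
  run-single mv t c h with corner? mv t c
  ... | yes _ = refl
  ... | no ¬h = ⊥-elim (¬h h)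

  run-∷ʳ : ∀ mv s w c {t} → run mv s w ≡ just t → (h : Corner mv t c) → run mv s (w ∷ʳ c) ≡ just (move mv t c h)
  run-∷ʳ mv s w c {t} eq h =
    trans (run-++ mv s w (c ∷ [])) (trans (cong (Maybe._>>= λ t → run mv t (c ∷ [])) eq) (run-single mv t c h))

  run-reverse : ∀ mv u {s t} → Reaches mv s u t → Reaches (opposite mv) t (reverse u) s
  run-reverse mv [] {s} {t} (_ , refl , s≐t) = t , refl , ≐-sym {s} {t} s≐t
  run-reverse mv (c ∷ u) {s} {t} (ν , eq , ν≐t) with corner? mv s c
  ... | yes h with run-reverse mv u (ν , eq , ν≐t)
  ...   | s₁ , eq₁ , s₁≐ = move (opposite mv) s₁ c h₁ , run-back , back≐s
    where
    s₂ = move mv s c h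
    h₂ = opposite-corner mv s c h
    h₁ : Corner (opposite mv) s₁ c
    h₁ = Corner-resp-≐ (opposite mv) (≐-sym {s₁} {s₂} s₁≐) c h₂
    run-back : run (opposite mv) t (reverse (c ∷ u)) ≡ just (move (opposite mv) s₁ c h₁)
    run-back = trans (cong (run (opposite mv) t) (LP.unfold-reverse c u)) (run-∷ʳ (opposite mv) t (reverse u) c eq₁ h₁)
    back≐s : move (opposite mv) s₁ c h₁ ≐ s
    back≐s = ≐-trans {move (opposite mv) s₁ c h₁} {move (opposite mv) s₂ c h₂} {s}
               (move-cong (opposite mv) s₁≐ c h₁ h₂) (move-opposite mv s c h h₂)

  _∈?_ : (P : Pt) (s : CP) → Dec (P ∈ₚ s)
  (x , y) ∈? s = y ℤP.≤? seq s x

  outside : CP → Pt → ℕ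
  outside s P with P ∈? s
  ... | yes _ = 0
  ... | no _ = 1

  outside-∈ : ∀ s P → P ∈ₚ s → outside s P ≡ 0
  outside-∈ s P p with P ∈? s
  ... | yes _ = refl
  ... | no np = ⊥-elim (np p)

  outside-∉ : ∀ s P → ¬ P ∈ₚ s → outside s P ≡ 1
  outside-∉ s P np with P ∈? s
  ... | yes p = ⊥-elim (np p)
  ... | no _ = refl

  outside-mono : ∀ s P Q → (¬ P ∈ₚ s → ¬ Q ∈ₚ s) → outside s P ℕ.≤ outside s Q
  outside-mono s P Q P∉⇒Q∉ with P ∈? s | Q ∈? s
  ... | yes _ | _ = z≤n
  ... | no _ | no _ = ℕP.≤-refl
  ... | no np | yes q = ⊥-elim (P∉⇒Q∉ np q)

  outside-resp-≡ᶜ : ∀ s {P Q} → P ≡ᶜ Q → outside s P ≡ outside s Q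
  outside-resp-≡ᶜ s {P} {Q} e =
    ℕP.≤-antisym (outside-mono s P Q (∉-resp-≡ᶜ s e)) (outside-mono s Q P (∉-resp-≡ᶜ s (≡ᶜ-sym {P} {Q} e)))

  -- The label of P counts the partitions of the run that no longer contain P,
  -- so the box removed at step j of m gets label m − j + 1.
  label : CP → List (Fin k) → Pt → ℕ
  label s [] P = 0
  label s (c ∷ w) P with corner? down s c
  ... | yes r = outside (removeCorner s c r) P ℕ.+ label (removeCorner s c r) w P
  ... | no _ = 0

  label-resp-≡ᶜ : ∀ s w {P Q} → P ≡ᶜ Q → label s w P ≡ label s w Q
  label-resp-≡ᶜ s [] e = refl
  label-resp-≡ᶜ s (c ∷ w) e with corner? down s c
  ... | yes r = cong₂ ℕ._+_ (outside-resp-≡ᶜ (removeCorner s c r) e) (label-resp-≡ᶜ (removeCorner s c r) w e)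
  ... | no _ = refl

  label-mono : ∀ s w P Q → ((s′ : CP) → ¬ P ∈ₚ s′ → ¬ Q ∈ₚ s′) → label s w P ℕ.≤ label s w Q
  label-mono s [] P Q f = z≤n
  label-mono s (c ∷ w) P Q f with corner? down s c
  ... | yes r = let s′ = removeCorner s c r in ℕP.+-mono-≤ (outside-mono s′ P Q (f s′)) (label-mono s′ w P Q f)
  ... | no _ = z≤n

  label-row-mono : ∀ s w x {y y′} → y ≤ y′ → label s w (x , y) ℕ.≤ label s w (x , y′)
  label-row-mono s w x y≤y′ = label-mono s w _ _ (λ s′ np q → np (ℤP.≤-trans y≤y′ q))

  label-column-mono : ∀ s w {x x′} y → x ≤ x′ → label s w (x , y) ℕ.≤ label s w (x′ , y)
  label-column-mono s w y x≤x′ = label-mono s w _ _ (λ s′ np q → np (ℤP.≤-trans q (decreasing s′ x≤x′)))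

  run-down-⊆ : ∀ s w {ν} → run down s w ≡ just ν → ∀ {P} → P ∈ₚ ν → P ∈ₚ s
  run-down-⊆ s [] refl p = p
  run-down-⊆ s (c ∷ w) eq p with corner? down s c
  ... | yes r = removeCorner-⊆ s c r (run-down-⊆ (removeCorner s c r) w eq p)

  label-outside : ∀ s w {ν} → run down s w ≡ just ν → ∀ {P} → ¬ P ∈ₚ s → label s w P ≡ length w
  label-outside s [] refl np = refl
  label-outside s (c ∷ w) eq {P} np with corner? down s c
  ... | yes r = cong₂ ℕ._+_ (outside-∉ s′ P np′) (label-outside s′ w eq np′)
    where
    s′ = removeCorner s c r
    np′ = np ∘ removeCorner-⊆ s c r

  label-corner : ∀ s c w {ν} → run down s (c ∷ w) ≡ just ν → label s (c ∷ w) (corner s c) ≡ suc (length w)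
  label-corner s c w eq with corner? down s c
  ... | yes r = cong₂ ℕ._+_ (outside-∉ s′ (corner s c) (corner-∉-removeCorner s c r))
                            (label-outside s′ w eq (corner-∉-removeCorner s c r))
    where
    s′ = removeCorner s c r

  corner-∉-run : ∀ s c w {ν} → run down s (c ∷ w) ≡ just ν → ¬ corner s c ∈ₚ ν
  corner-∉-run s c w eq with corner? down s c
  ... | yes r = corner-∉-removeCorner s c r ∘ run-down-⊆ (removeCorner s c r) w eq

  label-tail : ∀ s c w {ν} → run down s (c ∷ w) ≡ just ν → (r : Removable s c) →
               ∀ {P} → P ∈ₚ removeCorner s c r → label s (c ∷ w) P ≡ label (removeCorner s c r) w P
  label-tail s c w eq r {P} p with corner? down s c
  ... | yes _ = cong (ℕ._+ label (removeCorner s c r) w P) (outside-∈ (removeCorner s c r) P p)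

  label-range : ∀ s w {ν} → run down s w ≡ just ν → ∀ {P} → P ∈ₚ s → ¬ P ∈ₚ ν →
                1 ℕ.≤ label s w P × label s w P ℕ.≤ length w
  label-range s [] refl p np = ⊥-elim (np p)
  label-range s (c ∷ w) eq {P} p np with corner? down s c
  ... | yes r with P ∈? removeCorner s c r
  ...   | yes p′ = map₂ ℕP.m≤n⇒m≤1+n (label-range (removeCorner s c r) w eq p′ np)
  ...   | no np′ = s≤s z≤n , ℕP.≤-reflexive (cong suc (label-outside (removeCorner s c r) w eq np′))

  -- A box removed at the first step carries the maximal label, every later one a smaller label.
  label-injective : ∀ s w {ν} → run down s w ≡ just ν → ∀ {P Q} → P ∈ₚ s → ¬ P ∈ₚ ν → Q ∈ₚ s → ¬ Q ∈ₚ ν →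
                    label s w P ≡ label s w Q → P ≡ᶜ Q
  label-injective s [] refl p np q nq eq = ⊥-elim (np p)
  label-injective s (c ∷ w) eq′ {P} {Q} p np q nq eq with corner? down s c
  ... | yes r with P ∈? removeCorner s c r | Q ∈? removeCorner s c r
  ...   | yes p′ | yes q′ = label-injective (removeCorner s c r) w eq′ p′ np q′ nq eq
  ...   | no np′ | no nq′ =
    ≡ᶜ-trans {P} {corner s c} {Q} (≡ᶜ-sym {corner s c} {P} (removed-≡ᶜ-corner s c r p np′))
                                  (removed-≡ᶜ-corner s c r q nq′)
  ...   | no np′ | yes q′ = ⊥-elim (ℕP.<-irrefl refl (ℕP.<-≤-trans (ℕP.≤-reflexive too-big)
                              (proj₂ (label-range (removeCorner s c r) w eq′ q′ nq))))
    where
    too-big = trans (cong suc (sym (label-outside (removeCorner s c r) w eq′ np′))) eq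
  ...   | yes p′ | no nq′ = ⊥-elim (ℕP.<-irrefl refl (ℕP.<-≤-trans (ℕP.≤-reflexive too-big)
                              (proj₂ (label-range (removeCorner s c r) w eq′ p′ np))))
    where
    too-big = trans (cong suc (sym (label-outside (removeCorner s c r) w eq′ nq′))) (sym eq)

  label-surjective : ∀ s w {ν} → run down s w ≡ just ν → ∀ v → 1 ℕ.≤ v → v ℕ.≤ length w →
                     Σ Pt λ P → (P ∈ₚ s × ¬ P ∈ₚ ν) × label s w P ≡ v
  label-surjective s [] refl .0 () z≤n
  label-surjective s (c ∷ w) eq v 1≤v v≤ with corner? down s c
  ... | yes r with v ℕ.≟ suc (length w)
  ...   | yes refl = corner s c , (corner-∈ s c , corner-∉-removeCorner s c r ∘ run-down-⊆ s′ w eq) ,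
                     cong₂ ℕ._+_ (outside-∉ s′ (corner s c) (corner-∉-removeCorner s c r))
                                 (label-outside s′ w eq (corner-∉-removeCorner s c r))
    where
    s′ = removeCorner s c r
  ...   | no v≢ with label-surjective (removeCorner s c r) w eq v 1≤v (ℕP.≤-pred (ℕP.≤∧≢⇒< v≤ v≢))
  ...     | P , (p , np) , labelled =
    P , (removeCorner-⊆ s c r p , np) , cong₂ ℕ._+_ (outside-∈ (removeCorner s c r) P p) labelled

  InSkew⇒∈∉ : (s μ : CP) (P : Pt) → InSkew s μ P → P ∈ₚ s × ¬ P ∈ₚ μ
  InSkew⇒∈∉ s μ (x , y) (μx<y , y≤sx) = y≤sx , λ y≤μx → ℤP.<-irrefl refl (ℤP.<-≤-trans μx<y y≤μx)

  ∈∉⇒InSkew : (s μ : CP) (P : Pt) → P ∈ₚ s → ¬ P ∈ₚ μ → InSkew s μ P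
  ∈∉⇒InSkew s μ (x , y) p np = ℤP.≰⇒> np , p

  InSkew-resp-≐ : (s : CP) {μ ν : CP} → μ ≐ ν → (P : Pt) → InSkew s μ P → InSkew s ν P
  InSkew-resp-≐ s e (x , y) (μx<y , y≤sx) = subst (_< y) (e x) μx<y , y≤sx

  Boxes-resp-≐ : (s : CP) {μ ν : CP} → μ ≐ ν → Inverse (Boxes s μ) (Boxes s ν)
  Boxes-resp-≐ s {μ} {ν} e = record
    { to        = λ (P , h) → P , InSkew-resp-≐ s {μ} {ν} e P h
    ; from      = λ (P , h) → P , InSkew-resp-≐ s {ν} {μ} (≐-sym {μ} {ν} e) P h
    ; to-cong   = λ e → e
    ; from-cong = λ e → e
    ; inverse   = (λ e → e) , (λ e → e)
    }

  private
    pred-< : ∀ {v L} → 1 ℕ.≤ v → v ℕ.≤ L → v ℕ.∸ 1 ℕ.< L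
    pred-< {suc v} _ v<L = v<L

  run-boxes-card : (s : CP) (w : List (Fin k)) {ν : CP} → run down s w ≡ just ν → HasCard (Boxes s ν) (length w)
  run-boxes-card s w {ν} eq = record
    { to        = to
    ; from      = from
    ; to-cong   = λ {A} {B} A≡B →
                    FinP.fromℕ<-cong _ _ (cong (ℕ._∸ 1) (label-resp-≡ᶜ s w {proj₁ A} {proj₁ B} A≡B)) _ _
    ; from-cong = λ {i} {j} i≡j → from-cong i≡j
    ; inverse   = (λ {i} {A} → to-from {i} {A}) , (λ {A} {i} → from-to {A} {i})
    }
    where
    range : ∀ A → 1 ℕ.≤ label s w (proj₁ A) × label s w (proj₁ A) ℕ.≤ length w
    range (P , h) = let (p , np) = InSkew⇒∈∉ s ν P h in label-range s w eq p np
    to : Σ Pt (InSkew s ν) → Fin (length w)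
    to A = fromℕ< (pred-< (proj₁ (range A)) (proj₂ (range A)))
    preimage : (i : Fin (length w)) → Σ Pt λ P → (P ∈ₚ s × ¬ P ∈ₚ ν) × label s w P ≡ suc (toℕ i)
    preimage i = label-surjective s w eq (suc (toℕ i)) (s≤s z≤n) (FinP.toℕ<n i)
    from : Fin (length w) → Σ Pt (InSkew s ν)
    from i = let (P , (p , np) , _) = preimage i in P , ∈∉⇒InSkew s ν P p np
    from-cong : ∀ {i j} → i ≡ j → proj₁ (from i) ≡ᶜ proj₁ (from j)
    from-cong {i} refl = ≡ᶜ-refl {proj₁ (from i)}
    to-from : ∀ {i A} → proj₁ A ≡ᶜ proj₁ (from i) → to A ≡ i
    to-from {i} {A} A≡ = trans (FinP.fromℕ<-cong _ _ label-A _ (FinP.toℕ<n i)) (FinP.fromℕ<-toℕ i (FinP.toℕ<n i))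
      where
      label-A : label s w (proj₁ A) ℕ.∸ 1 ≡ toℕ i
      label-A = cong (ℕ._∸ 1)
        (trans (label-resp-≡ᶜ s w {proj₁ A} {proj₁ (from i)} A≡) (proj₂ (proj₂ (preimage i))))
    from-to : ∀ {A i} → i ≡ to A → proj₁ (from i) ≡ᶜ proj₁ A
    from-to {A} {i} refl =
      let (P , (p , np) , labelled) = preimage i
          (a , na) = InSkew⇒∈∉ s ν (proj₁ A) (proj₂ A)
      in label-injective s w eq p np a na
           (trans labelled (trans (cong suc (FinP.toℕ-fromℕ< _)) (suc-pred (proj₁ (range A)))))
      where
      suc-pred : ∀ {v} → 1 ℕ.≤ v → suc (v ℕ.∸ 1) ≡ v
      suc-pred {suc v} _ = refl

  tableau-of-run : (s μ : CP) (w : List (Fin k)) → Reaches down s w μ → SYT s μ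
  tableau-of-run s μ w (ν , eq , ν≐μ) = record
    { T          = label s w
    ; wellDef    = λ P Q _ P≡Q → label-resp-≡ᶜ s w {P} {Q} P≡Q
    ; rowWeak    = λ x y y′ _ _ → label-row-mono s w x
    ; colStrict  = column-strict
    ; p          = length w
    ; numBoxes   = Comp.inverse (Boxes-resp-≐ s {μ} {ν} μ≐ν) (run-boxes-card s w eq)
    ; inRange    = λ P h → let (p , np) = removed P h in label-range s w eq p np
    ; injective  = labels-injective
    ; surjective = labels-surjective
    }
    where
    μ≐ν = ≐-sym {ν} {μ} ν≐μ
    removed : ∀ P → InSkew s μ P → P ∈ₚ s × ¬ P ∈ₚ ν
    removed P h = InSkew⇒∈∉ s ν P (InSkew-resp-≐ s {μ} {ν} μ≐ν P h)
    labels-injective : ∀ P Q → InSkew s μ P → InSkew s μ Q → label s w P ≡ label s w Q → P ≡ᶜ Q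
    labels-injective P Q hP hQ = let (p , np) = removed P hP ; (q , nq) = removed Q hQ in label-injective s w eq p np q nq
    column-strict : ∀ x x′ y → InSkew s μ (x , y) → InSkew s μ (x′ , y) → x < x′ →
                    label s w (x , y) ℕ.< label s w (x′ , y)
    column-strict x x′ y h h′ x<x′ = ℕP.≤∧≢⇒< (label-column-mono s w y (ℤP.<⇒≤ x<x′))
      (λ eq′ → ℤP.<-irrefl (≡ᶜ-in-column⇒≡ (labels-injective (x , y) (x′ , y) h h′ eq′)) x<x′)
    labels-surjective : ∀ v → 1 ℕ.≤ v → v ℕ.≤ length w → Σ Pt λ P → InSkew s μ P × label s w P ≡ v
    labels-surjective v 1≤v v≤ = let (P , (p , np) , labelled) = label-surjective s w eq v 1≤v v≤ in
      P , InSkew-resp-≐ s {ν} {μ} ν≐μ P (∈∉⇒InSkew s ν P p np) , labelled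

  -- The conditions of SYT on a filling F, without the box count, which the peeling recursion below cannot maintain.
  record IsStandardFilling (F : Pt → ℕ) (s μ : CP) (p : ℕ) : Set where
    field
      F-resp-≡ᶜ    : ∀ P Q → InSkew s μ P → P ≡ᶜ Q → F P ≡ F Q
      F-row        : ∀ x y y′ → InSkew s μ (x , y) → InSkew s μ (x , y′) → y ≤ y′ → F (x , y) ℕ.≤ F (x , y′)
      F-column     : ∀ x x′ y → InSkew s μ (x , y) → InSkew s μ (x′ , y) → x < x′ → F (x , y) ℕ.< F (x′ , y)
      F-range      : ∀ P → InSkew s μ P → 1 ℕ.≤ F P × F P ℕ.≤ p
      F-injective  : ∀ P Q → InSkew s μ P → InSkew s μ Q → F P ≡ F Q → P ≡ᶜ Q
      F-surjective : ∀ v → 1 ℕ.≤ v → v ℕ.≤ p → Σ Pt λ P → InSkew s μ P × F P ≡ v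

  SYT-standard : ∀ {s μ} (S : SYT s μ) → IsStandardFilling (T S) s μ (SYT.p S)
  SYT-standard S = record
    { F-resp-≡ᶜ = wellDef S ; F-row = rowWeak S ; F-column = colStrict S
    ; F-range = inRange S ; F-injective = SYT.injective S ; F-surjective = SYT.surjective S }

  -- The largest entry sits at the end of its row above a strictly shorter row, i.e. in a removable corner;
  -- removing that corner leaves a standard filling with one entry less.
  module Peel (F : Pt → ℕ) (s μ : CP) (μ⊆s : μ ⊆ s) (p : ℕ) (std : IsStandardFilling F s μ (suc p)) where
    open IsStandardFilling std

    private
      top-entry = F-surjective (suc p) (s≤s z≤n) ℕP.≤-refl

    x y : ℤ
    x = proj₁ (proj₁ top-entry)
    y = proj₂ (proj₁ top-entry)

    top-in-skew : InSkew s μ (x , y)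
    top-in-skew = proj₁ (proj₂ top-entry)

    F-top : F (x , y) ≡ suc p
    F-top = proj₂ (proj₂ top-entry)

    entries-≤-top : ∀ P → InSkew s μ P → F P ℕ.≤ F (x , y)
    entries-≤-top P h = ℕP.≤-trans (proj₂ (F-range P h)) (ℕP.≤-reflexive (sym F-top))

    -- Opaque, so that the type checker never unfolds the top entry when comparing the runs of extracted words.
    opaque
      top-at-row-end : y ≡ seq s x
      top-at-row-end = ℤP.≤-antisym (proj₂ top-in-skew) (ℤP.≮⇒≥ not-inside)
        where
        not-inside : ¬ y < seq s x
        not-inside y<sx =
          ℤP.<-irrefl (≡ᶜ-in-row⇒≡ (F-injective (x , y) (x , y + 1ℤ) top-in-skew next same-entry)) (i<i+1 y)
          where
          next : InSkew s μ (x , y + 1ℤ)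
          next = ℤP.<-trans (proj₁ top-in-skew) (i<i+1 y) , <⇒+1≤ y<sx
          same-entry : F (x , y) ≡ F (x , y + 1ℤ)
          same-entry = ℕP.≤-antisym (F-row x y (y + 1ℤ) top-in-skew next (ℤP.<⇒≤ (i<i+1 y))) (entries-≤-top _ next)

      row-below-shorter : seq s (x + 1ℤ) < seq s x
      row-below-shorter = decidable-stable (seq s (x + 1ℤ) ℤP.<? seq s x) λ not-shorter →
        ℕP.<-irrefl refl (ℕP.<-≤-trans (F-column x (x + 1ℤ) y top-in-skew (below not-shorter) (i<i+1 x))
                                        (entries-≤-top _ (below not-shorter)))
        where
        below : ¬ seq s (x + 1ℤ) < seq s x → InSkew s μ (x + 1ℤ , y)
        below not-shorter = ℤP.≤-<-trans (decreasing μ (ℤP.<⇒≤ (i<i+1 x))) (proj₁ top-in-skew)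
                          , ℤP.≤-trans (ℤP.≤-reflexive top-at-row-end) (ℤP.≮⇒≥ not-shorter)

      class : Fin k
      class = fromℕ< (row<k x)

      row-x : row x ≡ toℕ class
      row-x = sym (FinP.toℕ-fromℕ< (row<k x))

      removable : Removable s class
      removable = removable-from-class s class row-x row-below-shorter

    peeled : CP
    peeled = removeCorner s class removable

    top-∉-peeled : ¬ (x , y) ∈ₚ peeled
    top-∉-peeled y≤ = ℤP.<-irrefl top-at-row-end (≤-1⇒< (subst (λ d → y ≤ seq s x - d) (δ-≡1 class row-x) y≤))

    corner≡ᶜtop : corner s class ≡ᶜ (x , y)
    corner≡ᶜtop = removed-≡ᶜ-corner s class removable (proj₂ top-in-skew) top-∉-peeled

    peeled-⊆ : ∀ {P} → InSkew peeled μ P → InSkew s μ P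
    peeled-⊆ {P} (μx<y , y≤) = μx<y , removeCorner-⊆ s class removable {P} y≤

    removed-is-top : ∀ {P} → P ∈ₚ s → ¬ P ∈ₚ peeled → (x , y) ≡ᶜ P
    removed-is-top {P} p np =
      ≡ᶜ-trans {x , y} {corner s class} {P} (≡ᶜ-sym {corner s class} {x , y} corner≡ᶜtop)
                                            (removed-≡ᶜ-corner s class removable p np)

    μ⊆peeled : μ ⊆ peeled
    μ⊆peeled i with row i ℕ.≟ toℕ class
    ... | no _ = subst (seq μ i ≤_) (sym (ℤP.+-identityʳ _)) (μ⊆s i)
    ... | yes e = <⇒≤-1 (ℤP.≰⇒> end-∉μ)
      where
      end-∉peeled : ¬ (i , seq s i) ∈ₚ peeled
      end-∉peeled q =
        ℤP.<-irrefl refl (ℤP.<-≤-trans (i-1<i (seq s i)) (subst (λ d → seq s i ≤ seq s i - d) (δ-≡1 class e) q))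
      end-∉μ : ¬ (i , seq s i) ∈ₚ μ
      end-∉μ =
        ∉-resp-≡ᶜ μ (removed-is-top ℤP.≤-refl end-∉peeled) (proj₂ (InSkew⇒∈∉ s μ (x , y) top-in-skew))

    peeled-standard : IsStandardFilling F peeled μ p
    peeled-standard = record
      { F-resp-≡ᶜ = λ P Q h → F-resp-≡ᶜ P Q (peeled-⊆ h)
      ; F-row = λ x y y′ h h′ → F-row x y y′ (peeled-⊆ h) (peeled-⊆ h′)
      ; F-column = λ x x′ y h h′ → F-column x x′ y (peeled-⊆ h) (peeled-⊆ h′)
      ; F-range = range
      ; F-injective = λ P Q h h′ → F-injective P Q (peeled-⊆ h) (peeled-⊆ h′)
      ; F-surjective = peeled-surjective
      }
      where
      not-top : ∀ {P} → InSkew peeled μ P → ¬ F P ≡ suc p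
      not-top {P} h FP≡ = top-∉-peeled (∈-resp-≡ᶜ peeled (≡ᶜ-sym {x , y} {P} same) (proj₂ h))
        where
        same = F-injective (x , y) P top-in-skew (peeled-⊆ h) (trans F-top (sym FP≡))
      range : ∀ P → InSkew peeled μ P → 1 ℕ.≤ F P × F P ℕ.≤ p
      range P h = let (1≤ , ≤suc) = F-range P (peeled-⊆ h) in 1≤ , ℕP.≤-pred (ℕP.≤∧≢⇒< ≤suc (not-top h))
      peeled-surjective : ∀ v → 1 ℕ.≤ v → v ℕ.≤ p → Σ Pt λ P → InSkew peeled μ P × F P ≡ v
      peeled-surjective v 1≤v v≤p with F-surjective v 1≤v (ℕP.m≤n⇒m≤1+n v≤p)
      ... | Q , h , FQ with Q ∈? peeled
      ...   | yes q = Q , (proj₁ h , q) , FQ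
      ...   | no nq = ⊥-elim (ℕP.<-irrefl refl (subst (ℕ._≤ p) (sym top≡v) v≤p))
        where
        top≡v = trans (sym F-top) (trans (F-resp-≡ᶜ (x , y) Q top-in-skew (removed-is-top (proj₂ h) nq)) FQ)

  extract : (F : Pt → ℕ) (s μ : CP) → μ ⊆ s → (p : ℕ) → IsStandardFilling F s μ p → List (Fin k)
  extract F s μ μ⊆s zero std = []
  extract F s μ μ⊆s (suc p) std =
    Peel.class F s μ μ⊆s p std ∷
    extract F (Peel.peeled F s μ μ⊆s p std) μ (Peel.μ⊆peeled F s μ μ⊆s p std) p
              (Peel.peeled-standard F s μ μ⊆s p std)

  module _ (F : Pt → ℕ) where

    extract-length : ∀ s μ μ⊆s p std → length (extract F s μ μ⊆s p std) ≡ p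
    extract-length s μ μ⊆s zero std = refl
    extract-length s μ μ⊆s (suc p) std = cong suc (extract-length P.peeled μ P.μ⊆peeled p P.peeled-standard)
      where
      module P = Peel F s μ μ⊆s p std

    empty-filling : ∀ s μ → μ ⊆ s → IsStandardFilling F s μ 0 → s ≐ μ
    empty-filling s μ μ⊆s std i with seq μ i ℤP.<? seq s i
    ... | yes μi<si = let (1≤ , ≤0) = IsStandardFilling.F-range std (i , seq s i) (μi<si , ℤP.≤-refl) in
                      ⊥-elim (ℕP.<-irrefl refl (ℕP.≤-trans 1≤ ≤0))
    ... | no μi≮si = ℤP.≤-antisym (ℤP.≮⇒≥ μi≮si) (μ⊆s i)

    extract-run : ∀ s μ μ⊆s p std → Reaches down s (extract F s μ μ⊆s p std) μ
    extract-run s μ μ⊆s zero std = s , refl , empty-filling s μ μ⊆s std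
    extract-run s μ μ⊆s (suc p) std with corner? down s (Peel.class F s μ μ⊆s p std)
    ... | yes _ = extract-run Pl.peeled μ Pl.μ⊆peeled p Pl.peeled-standard
      where
      module Pl = Peel F s μ μ⊆s p std
    ... | no ¬r = ⊥-elim (¬r (Peel.removable F s μ μ⊆s p std))

    extract-label : ∀ s μ μ⊆s p std → ∀ P → InSkew s μ P → label s (extract F s μ μ⊆s p std) P ≡ F P
    extract-label s μ μ⊆s zero std P h =
      let (1≤ , ≤0) = IsStandardFilling.F-range std P h in ⊥-elim (ℕP.<-irrefl refl (ℕP.≤-trans 1≤ ≤0))
    extract-label s μ μ⊆s (suc p) std P h with corner? down s (Peel.class F s μ μ⊆s p std)
    ... | no ¬r = ⊥-elim (¬r (Peel.removable F s μ μ⊆s p std))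
    ... | yes _ with P ∈? Peel.peeled F s μ μ⊆s p std
    ...   | yes q = extract-label Pl.peeled μ Pl.μ⊆peeled p Pl.peeled-standard P (proj₁ h , q)
      where
      module Pl = Peel F s μ μ⊆s p std
    ...   | no nq = begin
        suc (label Pl.peeled w P)  ≡⟨ cong suc (label-outside Pl.peeled w run-w nq) ⟩
        suc (length w)             ≡⟨ cong suc (extract-length Pl.peeled μ Pl.μ⊆peeled p Pl.peeled-standard) ⟩
        suc p                      ≡⟨ Pl.F-top ⟨
        F (Pl.x , Pl.y)            ≡⟨ IsStandardFilling.F-resp-≡ᶜ std _ P Pl.top-in-skew (Pl.removed-is-top (proj₂ h) nq) ⟩
        F P                        ∎
      where
      open ≡-Reasoning
      module Pl = Peel F s μ μ⊆s p std
      w = extract F Pl.peeled μ Pl.μ⊆peeled p Pl.peeled-standard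
      run-w = proj₁ (proj₂ (extract-run Pl.peeled μ Pl.μ⊆peeled p Pl.peeled-standard))

    -- A removal word whose labels reproduce F must peel the box carrying the largest entry first.
    extract-unique : ∀ s μ μ⊆s p std w → Reaches down s w μ →
                     (∀ P → InSkew s μ P → label s w P ≡ F P) → extract F s μ μ⊆s p std ≡ w
    extract-unique s μ μ⊆s zero std [] _ labels = refl
    extract-unique s μ μ⊆s zero std (c ∷ w) (ν , eq , ν≐μ) labels =
      let (P , (p , np) , labelled) = label-surjective s (c ∷ w) eq 1 (s≤s z≤n) (s≤s z≤n)
          h = InSkew-resp-≐ s {ν} {μ} ν≐μ P (∈∉⇒InSkew s ν P p np)
      in ⊥-elim (ℕP.<-irrefl refl (ℕP.≤-trans (ℕP.≤-reflexive (trans (sym labelled) (labels P h)))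
                                              (proj₂ (IsStandardFilling.F-range std P h))))
    extract-unique s μ μ⊆s (suc p) std [] (_ , refl , ν≐μ) labels =
      ⊥-elim (proj₂ (InSkew⇒∈∉ s μ _ Pl.top-in-skew) (subst (Pl.y ≤_) (ν≐μ Pl.x) (proj₂ Pl.top-in-skew)))
      where
      module Pl = Peel F s μ μ⊆s p std
    extract-unique s μ μ⊆s (suc p) std (c ∷ w) (ν , eq , ν≐μ) labels = peel-first c class≡c eq labels
      where
      module Pl = Peel F s μ μ⊆s p std
      removed : ∀ {P} → InSkew s μ P → P ∈ₚ s × ¬ P ∈ₚ ν
      removed {P} h = InSkew⇒∈∉ s ν P (InSkew-resp-≐ s {μ} {ν} (≐-sym {ν} {μ} ν≐μ) P h)
      corner-in-skew : InSkew s μ (corner s c)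
      corner-in-skew = InSkew-resp-≐ s {ν} {μ} ν≐μ _ (∈∉⇒InSkew s ν _ (corner-∈ s c) (corner-∉-run s c w eq))
      F-corner : F (corner s c) ≡ suc (length w)
      F-corner = trans (sym (labels _ corner-in-skew)) (label-corner s c w eq)
      length≡ : length w ≡ p
      length≡ = ℕP.suc-injective (ℕP.≤-antisym
        (ℕP.≤-trans (ℕP.≤-reflexive (sym F-corner)) (proj₂ (IsStandardFilling.F-range std _ corner-in-skew)))
        (ℕP.≤-trans (ℕP.≤-reflexive (trans (sym Pl.F-top) (sym (labels _ Pl.top-in-skew))))
                    (proj₂ (label-range s (c ∷ w) eq (proj₁ (removed Pl.top-in-skew)) (proj₂ (removed Pl.top-in-skew))))))
      top≡ᶜcorner : (Pl.x , Pl.y) ≡ᶜ corner s c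
      top≡ᶜcorner = label-injective s (c ∷ w) eq (proj₁ (removed Pl.top-in-skew)) (proj₂ (removed Pl.top-in-skew))
        (corner-∈ s c) (corner-∉-run s c w eq)
        (trans (labels _ Pl.top-in-skew) (trans Pl.F-top (trans (cong suc (sym length≡)) (sym (label-corner s c w eq)))))
      class≡c : Pl.class ≡ c
      class≡c = FinP.toℕ-injective
        (trans (sym Pl.row-x) (trans (sym (≡ᶜ⇒row≡ {Pl.x} {Pl.y} top≡ᶜcorner)) (row-ρ c)))
      peel-first : ∀ c′ → Pl.class ≡ c′ → run down s (c′ ∷ w) ≡ just ν →
                   (∀ P → InSkew s μ P → label s (c′ ∷ w) P ≡ F P) →
                   Pl.class ∷ extract F Pl.peeled μ Pl.μ⊆peeled p Pl.peeled-standard ≡ c′ ∷ w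
      peel-first _ refl eq′ labels′ = cong (Pl.class ∷_) (extract-unique Pl.peeled μ Pl.μ⊆peeled p Pl.peeled-standard w
        (ν , run-tail down s Pl.class w eq′ Pl.removable , ν≐μ)
        (λ P h → trans (sym (label-tail s Pl.class w eq′ Pl.removable (proj₂ h))) (labels′ P (Pl.peeled-⊆ h))))

  -- Two cylindric partitions agree everywhere once they agree on the rows 0, …, k − 1.
  agree-on-window : ℕ → CP → CP → Bool
  agree-on-window zero ν μ = true
  agree-on-window (suc j) ν μ with seq ν (+ j) ℤP.≟ seq μ (+ j)
  ... | yes _ = agree-on-window j ν μ
  ... | no _ = false

  _≐ᵇ_ : CP → CP → Bool
  ν ≐ᵇ μ = agree-on-window k ν μ

  ≐ᵇ-sound : ∀ ν μ → So (ν ≐ᵇ μ) → ν ≐ μ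
  ≐ᵇ-sound ν μ agree i = begin
      seq ν i                              ≡⟨ cong (seq ν) (row+quo i) ⟩
      seq ν (+ row i + quo i * K)          ≡⟨ seq-+-multiple ν (+ row i) (quo i) ⟩
      seq ν (+ row i) - quo i * D          ≡⟨ cong (_- quo i * D) (window k agree (row i) (row<k i)) ⟩
      seq μ (+ row i) - quo i * D          ≡⟨ seq-+-multiple μ (+ row i) (quo i) ⟨
      seq μ (+ row i + quo i * K)          ≡⟨ cong (seq μ) (row+quo i) ⟨
      seq μ i                              ∎
    where
    open ≡-Reasoning
    window : ∀ j → So (agree-on-window j ν μ) → ∀ r → r ℕ.< j → seq ν (+ r) ≡ seq μ (+ r)
    window (suc j) agree r r<j with seq ν (+ j) ℤP.≟ seq μ (+ j) | ℕP.m≤n⇒m<n∨m≡n (ℕP.≤-pred r<j)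
    ... | yes _ | inj₁ r<j′ = window j agree r r<j′
    ... | yes νj≡μj | inj₂ refl = νj≡μj

  ≐ᵇ-complete : ∀ ν μ → ν ≐ μ → So (ν ≐ᵇ μ)
  ≐ᵇ-complete ν μ ν≐μ = window k
    where
    window : ∀ j → So (agree-on-window j ν μ)
    window zero = _
    window (suc j) with seq ν (+ j) ℤP.≟ seq μ (+ j)
    ... | yes _ = window j
    ... | no νj≢μj = νj≢μj (ν≐μ (+ j))

  ends-at : Move → CP → CP → List (Fin k) → Bool
  ends-at mv s μ w with run mv s w
  ... | just ν = ν ≐ᵇ μ
  ... | nothing = false

  ends-at-sound : ∀ mv s μ w → So (ends-at mv s μ w) → Reaches mv s w μ
  ends-at-sound mv s μ w ends with run mv s w
  ... | just ν = ν , refl , ≐ᵇ-sound ν μ ends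

  ends-at-complete : ∀ mv s μ w → Reaches mv s w μ → So (ends-at mv s μ w)
  ends-at-complete mv s μ w (ν , eq , ν≐μ) with run mv s w
  ends-at-complete mv s μ w (ν , refl , ν≐μ) | just .ν = ≐ᵇ-complete ν μ ν≐μ

  Tableau-words : Move → CP → CP → ℕ → Setoid 0ℓ 0ℓ
  Tableau-words mv s μ m = Members (filterᵇ (ends-at mv s μ) (words k m))

  private
    ∈-filter⁺ : ∀ (P : List (Fin k) → Bool) ws {w} → w ∈ ws → So (P w) → w ∈ filterᵇ P ws
    ∈-filter⁺ P ws = MP.∈-filter⁺ (So? ∘ P)

    ∈-filter⁻ : ∀ (P : List (Fin k) → Bool) ws {w} → w ∈ filterᵇ P ws → w ∈ ws × So (P w)
    ∈-filter⁻ P ws = MP.∈-filter⁻ (So? ∘ P) {xs = ws}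

  tableaux↔removal-words : (s μ : CP) → μ ⊆ s → ∀ m → HasCard (Boxes s μ) m →
                           Inverse (SYTs s μ) (Tableau-words down s μ m)
  tableaux↔removal-words s μ μ⊆s m boxes = record
    { to        = λ S → word S , word-∈ S
    ; from      = λ (w , w∈) → tableau-of-run s μ w (reaches w∈)
    ; to-cong   = λ {S} {S′} S≈S′ → word-unique S (word S′) (word-reaches S′)
                                      (λ P h → trans (word-labels S′ P h) (sym (S≈S′ P h)))
    ; from-cong = λ w≡w′ P _ → cong (λ w → label s w P) w≡w′
    ; inverse   = (λ {(w , w∈)} {S} S≈w → word-unique S w (reaches w∈) (λ P h → sym (S≈w P h)))
                , (λ {S} w≡ P h → trans (cong (λ w → label s w P) w≡) (word-labels S P h))
    }
    where
    selected = filterᵇ (ends-at down s μ) (words k m)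
    reaches : ∀ {w} → w ∈ selected → Reaches down s w μ
    reaches {w} w∈ = ends-at-sound down s μ w (proj₂ (∈-filter⁻ (ends-at down s μ) (words k m) w∈))
    word : SYT s μ → List (Fin k)
    word S = extract (T S) s μ μ⊆s (SYT.p S) (SYT-standard S)
    word-reaches : ∀ S → Reaches down s (word S) μ
    word-reaches S = extract-run (T S) s μ μ⊆s (SYT.p S) (SYT-standard S)
    word-labels : ∀ S P → InSkew s μ P → label s (word S) P ≡ T S P
    word-labels S = extract-label (T S) s μ μ⊆s (SYT.p S) (SYT-standard S)
    word-unique : ∀ S w → Reaches down s w μ → (∀ P → InSkew s μ P → label s w P ≡ T S P) → word S ≡ w
    word-unique S = extract-unique (T S) s μ μ⊆s (SYT.p S) (SYT-standard S)
    word-∈ : ∀ S → word S ∈ selected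
    word-∈ S = ∈-filter⁺ (ends-at down s μ) (words k m)
                 (subst (λ l → word S ∈ words k l) length≡m (∈-words⁺ (word S)))
                 (ends-at-complete down s μ (word S) (word-reaches S))
      where
      length≡m = trans (extract-length (T S) s μ μ⊆s (SYT.p S) (SYT-standard S)) (HasCard-unique (numBoxes S) boxes)

  private
    ∈-words-reverse : ∀ {m w} → w ∈ words k m → reverse w ∈ words k m
    ∈-words-reverse {m} {w} w∈ =
      subst (λ l → reverse w ∈ words k l) (trans (LP.length-reverse w) (∈-words⁻ m w∈)) (∈-words⁺ (reverse w))

    reversed-word : ∀ mv s μ m → Σ (List (Fin k)) (_∈ filterᵇ (ends-at mv s μ) (words k m)) →
                    Σ (List (Fin k)) (_∈ filterᵇ (ends-at (opposite mv) μ s) (words k m))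
    reversed-word mv s μ m (w , w∈) =
      let (w∈′ , ends) = ∈-filter⁻ (ends-at mv s μ) (words k m) w∈
          reaches = run-reverse mv w (ends-at-sound mv s μ w ends)
      in reverse w , ∈-filter⁺ (ends-at (opposite mv) μ s) (words k m) (∈-words-reverse {m} w∈′)
                                (ends-at-complete (opposite mv) μ s (reverse w) reaches)

  removal↔addition-words : ∀ s μ m → Inverse (Tableau-words down s μ m) (Tableau-words up μ s m)
  removal↔addition-words s μ m = record
    { to        = reversed-word down s μ m
    ; from      = reversed-word up μ s m
    ; to-cong   = cong reverse
    ; from-cong = cong reverse
    ; inverse   = (λ {u} e → trans (cong reverse e) (LP.reverse-involutive (proj₁ u)))
                , (λ {w} e → trans (cong reverse e) (LP.reverse-involutive (proj₁ w)))
    }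

  Tableau-words-card : ∀ mv s μ m → HasCard (Tableau-words mv s μ m) (count (ends-at mv s μ) (words k m))
  Tableau-words-card mv s μ m = unique⇒members-card (UP.filter⁺ (So? ∘ ends-at mv s μ) (words-unique m))

  tableaux-card-down : ∀ s μ → μ ⊆ s → ∀ m → HasCard (Boxes s μ) m →
                       HasCard (SYTs s μ) (count (ends-at down s μ) (words k m))
  tableaux-card-down s μ μ⊆s m boxes =
    Comp.inverse (tableaux↔removal-words s μ μ⊆s m boxes) (Tableau-words-card down s μ m)

  tableaux-card-up : ∀ s μ → μ ⊆ s → ∀ m → HasCard (Boxes s μ) m →
                     HasCard (SYTs s μ) (count (ends-at up μ s) (words k m))
  tableaux-card-up s μ μ⊆s m boxes = Comp.inverse (tableaux↔removal-words s μ μ⊆s m boxes)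
    (Comp.inverse (removal↔addition-words s μ m) (Tableau-words-card up μ s m))

  succeeds : Move → CP → List (Fin k) → Bool
  succeeds mv s w with run mv s w
  ... | just _ = true
  ... | nothing = false

  indicator-≐ᵇ-true : ∀ {ν μ} → ν ≐ μ → indicator (ν ≐ᵇ μ) ≡ 1
  indicator-≐ᵇ-true {ν} {μ} ν≐μ with ν ≐ᵇ μ | ≐ᵇ-complete ν μ ν≐μ
  ... | true | _ = refl

  indicator-≐ᵇ-false : ∀ {ν μ} → ¬ ν ≐ μ → indicator (ν ≐ᵇ μ) ≡ 0
  indicator-≐ᵇ-false {ν} {μ} ν≠μ with ν ≐ᵇ μ | ≐ᵇ-sound ν μ
  ... | true | sound = ⊥-elim (ν≠μ (sound _))
  ... | false | _ = refl

  exactly-one-≐ : ∀ ν Ms → AllPairs (λ a b → ¬ a ≐ b) Ms → Any (ν ≐_) Ms →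
                  sum (map (λ μ → indicator (ν ≐ᵇ μ)) Ms) ≡ 1
  exactly-one-≐ ν (μ ∷ Ms) (μ≠ ∷ _) (here ν≐μ) = cong₂ ℕ._+_ (indicator-≐ᵇ-true {ν} {μ} ν≐μ)
    (trans (sum-map-cong (All.map (λ {μ′} μ≠μ′ ν≐μ′ → μ≠μ′ (≐-trans {μ} {ν} {μ′} (≐-sym {ν} {μ} ν≐μ) ν≐μ′)) μ≠)
                         (λ {μ′} → indicator-≐ᵇ-false {ν} {μ′}))
           (sum-map-zero Ms))
  exactly-one-≐ ν (μ ∷ Ms) (μ≠ ∷ distinct) (there ν∈) =
    cong₂ ℕ._+_ (indicator-≐ᵇ-false {ν} {μ} ν≠μ) (exactly-one-≐ ν Ms distinct ν∈)
    where
    ν≠μ : ¬ ν ≐ μ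
    ν≠μ ν≐μ = let (μ≠μ′ , ν≐μ′) = All.lookupAny μ≠ ν∈ in
      μ≠μ′ (≐-trans {μ} {ν} {Any.lookup ν∈} (≐-sym {ν} {μ} ν≐μ) ν≐μ′)

  sum-ends-at : ∀ mv s m (Ms : List CP) → AllPairs (λ a b → ¬ a ≐ b) Ms →
                (∀ w {ν} → w ∈ words k m → run mv s w ≡ just ν → Any (ν ≐_) Ms) →
                sum (map (λ μ → count (ends-at mv s μ) (words k m)) Ms) ≡ count (succeeds mv s) (words k m)
  sum-ends-at mv s m Ms distinct reached = sum-count Ms (ends-at mv s) (succeeds mv s) (words k m) matched
    where
    matched : ∀ w → w ∈ words k m → sum (map (λ μ → indicator (ends-at mv s μ w)) Ms) ≡ indicator (succeeds mv s w)
    matched w w∈ with run mv s w in eq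
    ... | nothing = sum-map-zero Ms
    ... | just ν = exactly-one-≐ ν Ms distinct (reached w w∈ eq)

  removal-ends-in-M : ∀ α m w {ν} → w ∈ words k m → run down α w ≡ just ν → InM α m ν
  removal-ends-in-M α m w {ν} w∈ eq = (λ i → run-down-⊆ α w eq {i , seq ν i} ℤP.≤-refl)
                                    , subst (HasCard (Boxes α ν)) (∈-words⁻ m w∈) (run-boxes-card α w eq)

  addition-ends-in-Λ : ∀ α m w {ν} → w ∈ words k m → run up α w ≡ just ν → InΛ α m ν
  addition-ends-in-Λ α m w {ν} w∈ eq with run-reverse up w (ν , eq , λ _ → refl)
  ... | α′ , eq′ , α′≐α = α⊆ν , Comp.inverse (Boxes-resp-≐ ν {α} {α′} (≐-sym {α′} {α} α′≐α)) boxes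
    where
    α⊆ν : α ⊆ ν
    α⊆ν i = subst (_≤ seq ν i) (α′≐α i) (run-down-⊆ ν (reverse w) eq′ {i , seq α′ i} ℤP.≤-refl)
    boxes : HasCard (Boxes ν α′) m
    boxes = subst (HasCard (Boxes ν α′)) (trans (LP.length-reverse w) (∈-words⁻ m w∈))
                  (run-boxes-card ν (reverse w) eq′)

  mutual
    walks : CP → List Move → ℕ
    walks s [] = 1
    walks s (mv ∷ mvs) = ∑[ c < k ] walks-via mv s c mvs

    walks-via : Move → CP → Fin k → List Move → ℕ
    walks-via mv s c mvs with corner? mv s c
    ... | yes h = walks (move mv s c h) mvs
    ... | no _ = 0

  mutual
    walks-cong : ∀ mvs {s s′} → s ≐ s′ → walks s mvs ≡ walks s′ mvs
    walks-cong [] e = refl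
    walks-cong (mv ∷ mvs) {s} {s′} e = sum-cong-≗ (λ c → walks-via-cong mv mvs {s} {s′} e c)

    walks-via-cong : ∀ mv mvs {s s′} → s ≐ s′ → ∀ c → walks-via mv s c mvs ≡ walks-via mv s′ c mvs
    walks-via-cong mv mvs {s} {s′} e c with corner? mv s c | corner? mv s′ c
    ... | yes h | yes h′ = walks-cong mvs (move-cong mv e c h h′)
    ... | yes h | no ¬h′ = ⊥-elim (¬h′ (Corner-resp-≐ mv e c h))
    ... | no ¬h | yes h′ = ⊥-elim (¬h (Corner-resp-≐ mv (≐-sym {s} {s′} e) c h′))
    ... | no _ | no _ = refl

  walks-∷-cong : ∀ {mvs mvs′} → (∀ t → walks t mvs ≡ walks t mvs′) →
                 ∀ mv s → walks s (mv ∷ mvs) ≡ walks s (mv ∷ mvs′)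
  walks-∷-cong {mvs} {mvs′} same mv s = sum-cong-≗ via
    where
    via : ∀ c → walks-via mv s c mvs ≡ walks-via mv s c mvs′
    via c with corner? mv s c
    ... | yes h = same (move mv s c h)
    ... | no _ = refl

  count-succeeds : ∀ mv m s → count (succeeds mv s) (words k m) ≡ walks s (replicate m mv)
  count-succeeds mv zero s = refl
  count-succeeds mv (suc m) s = trans (count-cartesian id (words k m) (succeeds mv s)) (sum-cong-≗ first-move)
    where
    first-move : ∀ c → count (λ w → succeeds mv s (c ∷ w)) (words k m) ≡ walks-via mv s c (replicate m mv)
    first-move c with corner? mv s c
    ... | yes h = count-succeeds mv m (move mv s c h)
    ... | no _ = count-none (words k m)

  private
    walks-via-[]-cong : ∀ mv mv′ s c c′ → Corner mv s c ⇔ Corner mv′ s c′ →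
                        walks-via mv s c [] ≡ walks-via mv′ s c′ []
    walks-via-[]-cong mv mv′ s c c′ h⇔h′ with corner? mv s c | corner? mv′ s c′
    ... | yes _ | yes _ = refl
    ... | no _ | no _ = refl
    ... | yes h | no ¬h′ = ⊥-elim (¬h′ (Equivalence.to h⇔h′ h))
    ... | no ¬h | yes h′ = ⊥-elim (¬h (Equivalence.from h⇔h′ h′))

  addable-suc⇔removable : ∀ s (c : Fin k′) → Addable s (Fin.suc c) ⇔ Removable s (Fin.inject₁ c)
  addable-suc⇔removable s c =
    mk⇔ (subst₂ (λ a b → seq s a < seq s b) ρ-suc ρ-pred)
        (subst₂ (λ a b → seq s a < seq s b) (sym ρ-suc) (sym ρ-pred))
    where
    ρ-suc : ρ (Fin.suc c) ≡ ρ (Fin.inject₁ c) + 1ℤ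
    ρ-suc = trans (cong +_ (ℕP.+-comm 1 (toℕ c))) (cong (λ i → + i + 1ℤ) (sym (FinP.toℕ-inject₁ c)))
    ρ-pred : ρ (Fin.suc c) - 1ℤ ≡ ρ (Fin.inject₁ c)
    ρ-pred = cong +_ (sym (FinP.toℕ-inject₁ c))

  addable-zero⇔removable-last : ∀ s → Addable s Fin.zero ⇔ Removable s (Fin.fromℕ k′)
  addable-zero⇔removable-last s =
    mk⇔ (λ a → +-cancelʳ-< D (subst₂ _<_ s0 s-1 a)) (λ r → subst₂ _<_ (sym s0) (sym s-1) (ℤP.+-monoˡ-< D r))
    where
    ρ-last : ρ (Fin.fromℕ k′) ≡ + k′
    ρ-last = cong +_ (FinP.toℕ-fromℕ k′)
    s0 : seq s 0ℤ ≡ seq s (ρ (Fin.fromℕ k′) + 1ℤ) + D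
    s0 = trans (periodic s 0ℤ)
               (cong (λ i → seq s i + D) (trans (cong +_ (ℕP.+-comm 1 k′)) (cong (_+ 1ℤ) (sym ρ-last))))
    s-1 : seq s (0ℤ - 1ℤ) ≡ seq s (ρ (Fin.fromℕ k′)) + D
    s-1 = trans (periodic s (0ℤ - 1ℤ)) (cong (λ i → seq s i + D) (sym ρ-last))

  addable-count≡removable-count : ∀ s → walks s (up ∷ []) ≡ walks s (down ∷ [])
  addable-count≡removable-count s = begin
      walks-via up s Fin.zero [] ℕ.+ ∑[ c < k′ ] walks-via up s (Fin.suc c) []
    ≡⟨ cong₂ ℕ._+_ (walks-via-[]-cong up down s Fin.zero (Fin.fromℕ k′) (addable-zero⇔removable-last s))
                   (sum-cong-≗ λ c → walks-via-[]-cong up down s (Fin.suc c) (Fin.inject₁ c) (addable-suc⇔removable s c)) ⟩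
      walks-via down s (Fin.fromℕ k′) [] ℕ.+ ∑[ c < k′ ] walks-via down s (Fin.inject₁ c) []
    ≡⟨ ℕP.+-comm (walks-via down s (Fin.fromℕ k′) []) _ ⟩
      ∑[ c < k′ ] walks-via down s (Fin.inject₁ c) [] ℕ.+ walks-via down s (Fin.fromℕ k′) []
    ≡⟨ sum-init-last (λ c → walks-via down s c []) ⟨
      walks s (down ∷ []) ∎
    where
    open ≡-Reasoning

  remove-then-add : CP → Fin k → Fin k → List Move → ℕ
  remove-then-add s c d mvs with corner? down s c
  ... | yes r = walks-via up (removeCorner s c r) d mvs
  ... | no _ = 0

  add-then-remove : CP → Fin k → Fin k → List Move → ℕ
  add-then-remove s c d mvs with corner? up s d
  ... | yes a = walks-via down (addCorner s d a) c mvs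
  ... | no _ = 0

  -- Two distinct classes c, d interact only when row class d follows c, i.e. when ρ d − 1 is a translate of ρ c;
  -- then the rows ρ d − 1, ρ d are translates of the rows ρ c, ρ c + 1.
  module Distinct-classes (s : CP) {c d : Fin k} (c≢d : ¬ c ≡ d) where

    private
      X X₁ Y Y₀ : ℤ
      X = seq s (ρ c)
      X₁ = seq s (ρ c + 1ℤ)
      Y = seq s (ρ d - 1ℤ)
      Y₀ = seq s (ρ d)

      translate : ∀ {a b} → row (a - 1ℤ) ≡ toℕ b → a ≡ ρ b + 1ℤ + quo (a - 1ℤ) * K
      translate {a} {b} e =
        trans (add-sub a) (trans (cong (_+ 1ℤ) (ρ-row (a - 1ℤ) e)) (move-multiple (ρ b) (quo (a - 1ℤ)) K 1ℤ))
        where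
        add-sub : ∀ a → a ≡ a - 1ℤ + 1ℤ
        add-sub = solve-∀

    follows⇒ : row (ρ d - 1ℤ) ≡ toℕ c → row (ρ c + 1ℤ) ≡ toℕ d
    follows⇒ e = trans (cong row ρc+1≡) (trans (row-+-multiple (ρ d) (- q)) (row-ρ d))
      where
      q = quo (ρ d - 1ℤ)
      ρc+1≡ : ρ c + 1ℤ ≡ ρ d + (- q) * K
      ρc+1≡ = trans (cancel (ρ c + 1ℤ) q K) (cong (_+ (- q) * K) (sym (translate {ρ d} e)))
        where
        cancel : ∀ a q K → a ≡ a + q * K + (- q) * K
        cancel = solve-∀

    follows⇐ : row (ρ c + 1ℤ) ≡ toℕ d → row (ρ d - 1ℤ) ≡ toℕ c
    follows⇐ e = trans (cong row ρd-1≡) (trans (row-+-multiple (ρ c) (- q)) (row-ρ c))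
      where
      q = quo (ρ c + 1ℤ)
      ρd-1≡ : ρ d - 1ℤ ≡ ρ c + (- q) * K
      ρd-1≡ = trans (add-sub (ρ d) q K)
                    (trans (cong (λ z → z - q * K - 1ℤ) (sym (ρ-row (ρ c + 1ℤ) e))) (cancel (ρ c) q K))
        where
        add-sub : ∀ a q K → a - 1ℤ ≡ a + q * K - q * K - 1ℤ
        add-sub = solve-∀
        cancel : ∀ a q K → a + 1ℤ - q * K - 1ℤ ≡ a + (- q) * K
        cancel = solve-∀

    private
      δc-at-d : δ c (ρ d) ≡ 0ℤ
      δc-at-d = δ-ρ-other c≢d

      δd-at-c : δ d (ρ c) ≡ 0ℤ
      δd-at-c = δ-ρ-other (c≢d ∘ sym)

      x-δ≤x : ∀ c′ i x → x - δ c′ i ≤ x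
      x-δ≤x c′ i x with δ-cases c′ i
      ... | inj₁ (_ , δ≡1) rewrite δ≡1 = ℤP.<⇒≤ (i-1<i x)
      ... | inj₂ (_ , δ≡0) rewrite δ≡0 = ℤP.≤-reflexive (ℤP.+-identityʳ x)

      x≤x+δ : ∀ c′ i x → x ≤ x + δ c′ i
      x≤x+δ c′ i x with δ-cases c′ i
      ... | inj₁ (_ , δ≡1) rewrite δ≡1 = ℤP.<⇒≤ (i<i+1 x)
      ... | inj₂ (_ , δ≡0) rewrite δ≡0 = ℤP.≤-reflexive (sym (ℤP.+-identityʳ x))

      translated : row (ρ d - 1ℤ) ≡ toℕ c → Y ≡ X - quo (ρ d - 1ℤ) * D × Y₀ ≡ X₁ - quo (ρ d - 1ℤ) * D
      translated e = trans (cong (seq s) (ρ-row (ρ d - 1ℤ) e)) (seq-+-multiple s (ρ c) q)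
                   , trans (cong (seq s) (translate {ρ d} e)) (seq-+-multiple s (ρ c + 1ℤ) q)
        where
        q = quo (ρ d - 1ℤ)

      shift-< : ∀ {a b a′ b′} t → a′ ≡ a - t → b′ ≡ b - t → a + 1ℤ < b + 0ℤ → a′ - 0ℤ < b′ - 1ℤ
      shift-< {a} {b} t refl refl p = subst₂ _<_ (left a t) (right b t) (ℤP.+-monoˡ-< (- t - 1ℤ) p)
        where
        left : ∀ a t → a + 1ℤ + (- t - 1ℤ) ≡ a - t - 0ℤ
        left = solve-∀
        right : ∀ b t → b + 0ℤ + (- t - 1ℤ) ≡ b - t - 1ℤ
        right = solve-∀

      unshift-< : ∀ {a b a′ b′} t → a′ ≡ a - t → b′ ≡ b - t → a′ - 0ℤ < b′ - 1ℤ → a + 1ℤ < b + 0ℤ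
      unshift-< {a} {b} t refl refl p = +-cancelʳ-< (- t - 1ℤ) (subst₂ _<_ (sym (left a t)) (sym (right b t)) p)
        where
        left : ∀ a t → a + 1ℤ + (- t - 1ℤ) ≡ a - t - 0ℤ
        left = solve-∀
        right : ∀ b t → b + 0ℤ + (- t - 1ℤ) ≡ b - t - 1ℤ
        right = solve-∀

    addable-after-removal⇒addable : .(r : Removable s c) → Addable (removeCorner s c r) d → Addable s d
    addable-after-removal⇒addable r h =
      ℤP.<-≤-trans (subst (_< Y - δ c (ρ d - 1ℤ)) Y₀-0 h) (x-δ≤x c (ρ d - 1ℤ) Y)
      where
      Y₀-0 : Y₀ - δ c (ρ d) ≡ Y₀
      Y₀-0 = trans (cong (λ t → Y₀ - t) δc-at-d) (ℤP.+-identityʳ Y₀)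

    removable-after-addition⇒removable : .(a : Addable s d) → Removable (addCorner s d a) c → Removable s c
    removable-after-addition⇒removable a h =
      ℤP.≤-<-trans (x≤x+δ d (ρ c + 1ℤ) X₁) (subst (X₁ + δ d (ρ c + 1ℤ) <_) X+0 h)
      where
      X+0 : X + δ d (ρ c) ≡ X
      X+0 = trans (cong (λ t → X + t) δd-at-c) (ℤP.+-identityʳ X)

    addable-after-removal⇒removable-after-addition : (r : Removable s c) (a : Addable s d) →
      Addable (removeCorner s c r) d → Removable (addCorner s d a) c
    addable-after-removal⇒removable-after-addition r a h with δ-cases c (ρ d - 1ℤ)
    ... | inj₁ (e , δ≡1) = let (eY , eY₀) = translated e in
      subst₂ (λ t t′ → X₁ + t < X + t′) (sym (δ-≡1 d (follows⇒ e))) (sym δd-at-c)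
        (unshift-< {X₁} {X} (quo (ρ d - 1ℤ) * D) eY₀ eY (subst₂ (λ t t′ → Y₀ - t < Y - t′) δc-at-d δ≡1 h))
    ... | inj₂ (ne , _) =
      subst₂ (λ t t′ → X₁ + t < X + t′) (sym (δ-≡0 d (ne ∘ follows⇐))) (sym δd-at-c) (ℤP.+-monoˡ-< 0ℤ r)

    removable-after-addition⇒addable-after-removal : (r : Removable s c) (a : Addable s d) →
      Removable (addCorner s d a) c → Addable (removeCorner s c r) d
    removable-after-addition⇒addable-after-removal r a h with δ-cases c (ρ d - 1ℤ)
    ... | inj₁ (e , δ≡1) = let (eY , eY₀) = translated e in
      subst₂ (λ t t′ → Y₀ - t < Y - t′) (sym δc-at-d) (sym δ≡1)
        (shift-< {X₁} {X} (quo (ρ d - 1ℤ) * D) eY₀ eY (subst₂ (λ t t′ → X₁ + t < X + t′) (δ-≡1 d (follows⇒ e)) δd-at-c h))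
    ... | inj₂ (_ , δ≡0) =
      subst₂ (λ t t′ → Y₀ - t < Y - t′) (sym δc-at-d) (sym δ≡0) (ℤP.+-monoˡ-< 0ℤ a)

    remove-then-add≡add-then-remove : ∀ mvs → remove-then-add s c d mvs ≡ add-then-remove s c d mvs
    remove-then-add≡add-then-remove mvs with corner? down s c | corner? up s d
    ... | no _ | no _ = refl
    ... | yes r | no ¬a with corner? up (removeCorner s c r) d
    ...   | yes a′ = ⊥-elim (¬a (addable-after-removal⇒addable r a′))
    ...   | no _ = refl
    remove-then-add≡add-then-remove mvs | no ¬r | yes a with corner? down (addCorner s d a) c
    ...   | yes r′ = ⊥-elim (¬r (removable-after-addition⇒removable a r′))
    ...   | no _ = refl
    remove-then-add≡add-then-remove mvs | yes r | yes a
      with corner? up (removeCorner s c r) d | corner? down (addCorner s d a) c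
    ...   | yes _ | yes _ = walks-cong mvs (λ i → swap (seq s i) (δ c i) (δ d i))
      where
      swap : ∀ x p q → x - p + q ≡ x + q - p
      swap = solve-∀
    ...   | yes a′ | no ¬r′ = ⊥-elim (¬r′ (addable-after-removal⇒removable-after-addition r a a′))
    ...   | no ¬a′ | yes r′ = ⊥-elim (¬a′ (removable-after-addition⇒addable-after-removal r a r′))
    ...   | no _ | no _ = refl

  walks-down-up : ∀ s c mvs → walks-via down s c (up ∷ mvs) ≡ ∑[ d < k ] remove-then-add s c d mvs
  walks-down-up s c mvs with corner? down s c
  ... | yes _ = refl
  ... | no _ = sym (sum-replicate-zero k)

  walks-up-down : ∀ s d mvs → walks-via up s d (down ∷ mvs) ≡ ∑[ c < k ] add-then-remove s c d mvs
  walks-up-down s d mvs with corner? up s d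
  ... | yes _ = refl
  ... | no _ = sym (sum-replicate-zero k)

  remove-then-add-diagonal : ∀ s c mvs → remove-then-add s c c mvs ≡ walks-via down s c [] ℕ.* walks s mvs
  remove-then-add-diagonal s c mvs with corner? down s c
  ... | no _ = refl
  ... | yes r with corner? up (removeCorner s c r) c
  ...   | no ¬a = ⊥-elim (¬a (removeCorner-addable s c r))
  ...   | yes a = trans (walks-cong mvs (addCorner-removeCorner s c r a)) (sym (ℕP.+-identityʳ _))

  add-then-remove-diagonal : ∀ s c mvs → add-then-remove s c c mvs ≡ walks-via up s c [] ℕ.* walks s mvs
  add-then-remove-diagonal s c mvs with corner? up s c
  ... | no _ = refl
  ... | yes a with corner? down (addCorner s c a) c
  ...   | no ¬r = ⊥-elim (¬r (addCorner-removable s c a))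
  ...   | yes r = trans (walks-cong mvs (removeCorner-addCorner s c a r)) (sym (ℕP.+-identityʳ _))


  private
    split-diagonal : (H : Fin k → Fin k → ℕ) →
                     ∑[ c < k ] ∑[ d < k ] H c d ≡ ∑[ c < k ] H c c ℕ.+ ∑[ c < k ] ∑[ j < k′ ] H c (Fin.punchIn c j)
    split-diagonal H = trans (sum-cong-≗ (λ c → sum-remove {i = c} (H c)))
                             (∑-distrib-+ (λ c → H c c) (λ c → ∑[ j < k′ ] H c (Fin.punchIn c j)))

  -- Off the diagonal the two orders give the same walks; on it, both count one corner times walks s mvs,
  -- and there are as many addable as removable corners.
  down-up≡up-down : ∀ s mvs → walks s (down ∷ up ∷ mvs) ≡ walks s (up ∷ down ∷ mvs)
  down-up≡up-down s mvs = begin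
      ∑[ c < k ] walks-via down s c (up ∷ mvs)
    ≡⟨ sum-cong-≗ (λ c → walks-down-up s c mvs) ⟩
      ∑[ c < k ] ∑[ d < k ] remove-then-add s c d mvs
    ≡⟨ split-diagonal (λ c d → remove-then-add s c d mvs) ⟩
      ∑[ c < k ] remove-then-add s c c mvs ℕ.+ ∑[ c < k ] ∑[ j < k′ ] remove-then-add s c (Fin.punchIn c j) mvs
    ≡⟨ cong₂ ℕ._+_ diagonal off-diagonal ⟩
      ∑[ c < k ] add-then-remove s c c mvs ℕ.+ ∑[ c < k ] ∑[ j < k′ ] add-then-remove s c (Fin.punchIn c j) mvs
    ≡⟨ split-diagonal (λ c d → add-then-remove s c d mvs) ⟨
      ∑[ c < k ] ∑[ d < k ] add-then-remove s c d mvs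
    ≡⟨ ∑-comm (λ c d → add-then-remove s c d mvs) ⟩
      ∑[ d < k ] ∑[ c < k ] add-then-remove s c d mvs
    ≡⟨ sum-cong-≗ (λ d → walks-up-down s d mvs) ⟨
      ∑[ d < k ] walks-via up s d (down ∷ mvs) ∎
    where
    open ≡-Reasoning
    diagonal : ∑[ c < k ] remove-then-add s c c mvs ≡ ∑[ c < k ] add-then-remove s c c mvs
    diagonal = begin
        ∑[ c < k ] remove-then-add s c c mvs             ≡⟨ sum-cong-≗ (λ c → remove-then-add-diagonal s c mvs) ⟩
        ∑[ c < k ] (walks-via down s c [] ℕ.* walks s mvs) ≡⟨ *-distribʳ-sum (walks s mvs) (λ c → walks-via down s c []) ⟨
        walks s (down ∷ []) ℕ.* walks s mvs             ≡⟨ cong (ℕ._* walks s mvs) (addable-count≡removable-count s) ⟨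
        walks s (up ∷ []) ℕ.* walks s mvs               ≡⟨ *-distribʳ-sum (walks s mvs) (λ c → walks-via up s c []) ⟩
        ∑[ c < k ] (walks-via up s c [] ℕ.* walks s mvs)   ≡⟨ sum-cong-≗ (λ c → add-then-remove-diagonal s c mvs) ⟨
        ∑[ c < k ] add-then-remove s c c mvs             ∎
    off-diagonal : ∑[ c < k ] ∑[ j < k′ ] remove-then-add s c (Fin.punchIn c j) mvs
                 ≡ ∑[ c < k ] ∑[ j < k′ ] add-then-remove s c (Fin.punchIn c j) mvs
    off-diagonal = sum-cong-≗ λ c → sum-cong-≗ λ j →
      Distinct-classes.remove-then-add≡add-then-remove s (FinP.punchInᵢ≢i c j ∘ sym) mvs

  down-first≡up-first : ∀ mvs s → walks s (down ∷ mvs) ≡ walks s (up ∷ mvs)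
  down-first≡up-first [] s = sym (addable-count≡removable-count s)
  down-first≡up-first (down ∷ mvs) s =
    trans (walks-∷-cong (down-first≡up-first mvs) down s) (down-up≡up-down s mvs)
  down-first≡up-first (up ∷ mvs) s =
    trans (down-up≡up-down s mvs) (walks-∷-cong (down-first≡up-first mvs) up s)

  removal-walks≡addition-walks : ∀ m s → walks s (replicate m down) ≡ walks s (replicate m up)
  removal-walks≡addition-walks zero s = refl
  removal-walks≡addition-walks (suc m) s =
    trans (walks-∷-cong (removal-walks≡addition-walks m) down s) (down-first≡up-first (replicate m up) s)

  tableaux-below≡tableaux-above :
    (α : CP) (m : ℕ) (f : CP → CP → ℕ) → (∀ λ′ μ → μ ⊆ λ′ → fIs λ′ μ (f λ′ μ)) →
    (Ms : List CP) → Enumerates (InM α m) Ms → (Ls : List CP) → Enumerates (InΛ α m) Ls →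
    sum (map (λ μ → f α μ) Ms) ≡ sum (map (λ λ′ → f λ′ α) Ls)
  tableaux-below≡tableaux-above α m f f-card Ms (inM , completeM , distinctM) Ls (inΛ , completeΛ , distinctΛ) = begin
      sum (map (λ μ → f α μ) Ms)                                  ≡⟨ sum-map-cong inM f≡removal-words ⟩
      sum (map (λ μ → count (ends-at down α μ) (words k m)) Ms)   ≡⟨ sum-ends-at down α m Ms distinctM in-Ms ⟩
      count (succeeds down α) (words k m)                         ≡⟨ count-succeeds down m α ⟩
      walks α (replicate m down)                                  ≡⟨ removal-walks≡addition-walks m α ⟩
      walks α (replicate m up)                                    ≡⟨ count-succeeds up m α ⟨
      count (succeeds up α) (words k m)                           ≡⟨ sum-ends-at up α m Ls distinctΛ in-Ls ⟨
      sum (map (λ λ′ → count (ends-at up α λ′) (words k m)) Ls)   ≡⟨ sum-map-cong inΛ f≡addition-words ⟨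
      sum (map (λ λ′ → f λ′ α) Ls)                                ∎
    where
    open ≡-Reasoning
    f≡removal-words : ∀ {μ} → InM α m μ → f α μ ≡ count (ends-at down α μ) (words k m)
    f≡removal-words {μ} (μ⊆α , boxes) = HasCard-unique (f-card α μ μ⊆α) (tableaux-card-down α μ μ⊆α m boxes)
    f≡addition-words : ∀ {λ′} → InΛ α m λ′ → f λ′ α ≡ count (ends-at up α λ′) (words k m)
    f≡addition-words {λ′} (α⊆λ′ , boxes) = HasCard-unique (f-card λ′ α α⊆λ′) (tableaux-card-up λ′ α α⊆λ′ m boxes)
    in-Ms : ∀ w {ν} → w ∈ words k m → run down α w ≡ just ν → Any (ν ≐_) Ms
    in-Ms w {ν} w∈ eq = completeM ν (removal-ends-in-M α m w w∈ eq)
    in-Ls : ∀ w {ν} → w ∈ words k m → run up α w ≡ just ν → Any (ν ≐_) Ls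
    in-Ls w {ν} w∈ eq = completeΛ ν (addition-ends-in-Λ α m w w∈ eq)

open import Data.Nat using (_<_)

mainTheorem4 : (k n : ℕ) → 0 < k → k < n →
    (α : CylPart k n) (m : ℕ) →
    (f : CylPart k n → CylPart k n → ℕ) →
    (∀ λ' μ → μ ⊆ λ' → fIs λ' μ (f λ' μ)) →
    (Ms : List (CylPart k n)) → Enumerates (InM α m) Ms →
    (Ls : List (CylPart k n)) → Enumerates (InΛ α m) Ls →
    sum (map (λ μ → f α μ) Ms) ≡ sum (map (λ λ' → f λ' α) Ls)
mainTheorem4 zero n () k<n
mainTheorem4 (suc k′) n _ k<n = Cylinder.tableaux-below≡tableaux-above k′ n k<n
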